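{- Let $G$ be a planar graph of girth at least $5$ that is not $(3,4)$-colorable, chosen so that it has the minimum number of vertices of degree at least $3$ among all such graphs, and subject to this, $|V(G)|+|E(G)|$ is minimum. Then every edge $xy$ of $G$ has an endpoint of degree at least $5$.
   Context: All graphs are finite and simple; girth is the length of a shortest cycle. A graph is $(3,4)$-colorable if its vertices can be colored with colors $\{3,4\}$ so that every vertex of color $i$ has at most $i$ neighbors of color $i$ (equivalently, its vertex set can be partitioned into two sets inducing subgraphs of maximum degree at most $3$ and at most $4$ respectively). -}

module Defs where

open import Data.Nat using (ℕ; zero; suc; _+_; _*_; _≤_; _<_; _≤ᵇ_; _<ᵇ_)
open import Data.Fin using (Fin; zero; suc; toℕ; inject₁; fromℕ)
open import Data.Bool using (Bool; true; false; T; _∧_; if_then_else_)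
open import Data.Product using (Σ; _×_; _,_; ∃; ∃-syntax)
open import Data.Sum using (_⊎_)
open import Data.Empty using (⊥)
open import Relation.Nullary using (¬_)
open import Relation.Binary.PropositionalEquality using (_≡_)
open import Function using (_∘_; Injective)
open import Function.Bundles using (_⇔_)
open import Relation.Binary.Construct.Closure.ReflexiveTransitive using (Star)

record Graph (n : ℕ) : Set where
  field
    adj    : Fin n → Fin n → Bool
    sym    : ∀ u v → adj u v ≡ adj v u
    irrefl : ∀ v → adj v v ≡ false
open Graph public

Adj : ∀ {n} → Graph n → Fin n → Fin n → Set
Adj G u v = T (adj G u v)

countTrue : ∀ {n} → (Fin n → Bool) → ℕ
countTrue {zero}  f = 0
countTrue {suc n} f = (if f zero then 1 else 0) + countTrue (f ∘ suc)

sumFin : ∀ {n} → (Fin n → ℕ) → ℕ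
sumFin {zero}  f = 0
sumFin {suc n} f = f zero + sumFin (f ∘ suc)

deg : ∀ {n} → Graph n → Fin n → ℕ
deg G v = countTrue (adj G v)

numEdges : ∀ {n} → Graph n → ℕ
numEdges G = sumFin (λ i → countTrue (λ j → adj G i j ∧ (toℕ i <ᵇ toℕ j)))

size : ∀ {n} → Graph n → ℕ
size {n} G = n + numEdges G

numBig : ∀ {n} → Graph n → ℕ
numBig G = countTrue (λ v → 3 ≤ᵇ deg G v)

-- a cycle of length (suc m) : distinct vertices f 0, …, f m with
-- f i ~ f (i+1) and f m ~ f 0
IsCycle : ∀ {n} → Graph n → (m : ℕ) → (Fin (suc m) → Fin n) → Set
IsCycle G m f =
  Injective _≡_ _≡_ f ×
  ((i : Fin m) → Adj G (f (inject₁ i)) (f (suc i))) ×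
  Adj G (f (fromℕ m)) (f zero)

GirthAtLeast : ∀ {n} → ℕ → Graph n → Set
GirthAtLeast g G =
  ∀ m → 3 ≤ suc m → suc m < g → (f : Fin (suc m) → Fin _) → ¬ IsCycle G m f

data Color : Set where
  c3 c4 : Color

capacity : Color → ℕ
capacity c3 = 3
capacity c4 = 4

sameColor : Color → Color → Bool
sameColor c3 c3 = true
sameColor c4 c4 = true
sameColor _  _  = false

Is34Coloring : ∀ {n} → Graph n → (Fin n → Color) → Set
Is34Coloring G col =
  ∀ v → countTrue (λ w → adj G v w ∧ sameColor (col w) (col v)) ≤ capacity (col v)

Colorable34 : ∀ {n} → Graph n → Set
Colorable34 {n} G = Σ (Fin n → Color) (Is34Coloring G)

iter : ∀ {A : Set} → (A → A) → A → ℕ → A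
iter f x zero    = x
iter f x (suc k) = f (iter f x k)

-- Planarity, via combinatorial embeddings (rotation systems) of genus 0

-- A rotation system: for each vertex v, a cyclic permutation rot v of
-- the neighbours of v.
record Rotation {n} (G : Graph n) : Set where
  field
    rot       : Fin n → Fin n → Fin n
    rot-adj   : ∀ v u → Adj G v u → Adj G v (rot v u)
    rot-inj   : ∀ v u u' → Adj G v u → Adj G v u' → rot v u ≡ rot v u' → u ≡ u'
    rot-cyc   : ∀ v u u' → Adj G v u → Adj G v u' →
                ∃[ k ] iter (rot v) u k ≡ u'
  -- face-tracing permutation on darts (u , v): (u , v) ↦ (v , rot v u)
  faceStep : Fin n × Fin n → Fin n × Fin n
  faceStep (u , v) = (v , rot v u)
open Rotation public

Dart : ∀ {n} → Graph n → Set
Dart {n} G = Σ (Fin n × Fin n) (λ { (u , v) → Adj G u v })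

SameFace : ∀ {n} {G : Graph n} → Rotation G → Fin n × Fin n → Fin n × Fin n → Set
SameFace R d d' = ∃[ k ] iter (faceStep R) d k ≡ d'

Connected : ∀ {n} → Graph n → Fin n → Fin n → Set
Connected G = Star (Adj G)

-- G is planar: it has a rotation system whose face count F satisfies
-- Euler's formula  V − E + (F + I) = 2C, where C is the number of
-- connected components and I the number of isolated vertices (each of
-- which is counted as contributing one face).  Faces are the orbits of
-- faceStep on darts, components the classes of Connected; both counts
-- are given by surjective labellings whose fibres are exactly the classes.
record PlanarEmbedding {n} (G : Graph n) : Set where
  field
    R          : Rotation G
    F          : ℕ
    face       : Dart G → Fin F
    face-eq    : ∀ (d d' : Dart G) →
                 (face d ≡ face d') ⇔ SameFace R (Data.Product.proj₁ d) (Data.Product.proj₁ d')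
    face-surj  : ∀ (f : Fin F) → ∃[ d ] face d ≡ f
    C          : ℕ
    comp       : Fin n → Fin C
    comp-eq    : ∀ u v → (comp u ≡ comp v) ⇔ Connected G u v
    comp-surj  : ∀ (c : Fin C) → ∃[ v ] comp v ≡ c
    euler      : n + (F + countTrue (λ v → deg G v ≤ᵇ 0)) ≡ 2 * C + numEdges G

Planar : ∀ {n} → Graph n → Set
Planar G = PlanarEmbedding G

InClass : ∀ {n} → Graph n → Set
InClass G = Planar G × GirthAtLeast 5 G × ¬ Colorable34 G

Minimal : ∀ {n} → Graph n → Set
Minimal G = ∀ m (H : Graph m) → InClass H →
  numBig G ≤ numBig H × (numBig G ≡ numBig H → size G ≤ size H)

module Submission where

-- Let G be a minimal counterexample (planar, girth ≥ 5, not (3,4)-colourable,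
-- lexicographically minimal in (numBig, |V| + |E|)) and xy an edge with
-- deg x ≤ 4 and deg y ≤ 4.  Then H = G − xy is again in the class:
--   * girth does not decrease when an edge is deleted;
--   * H is not (3,4)-colourable, since a colouring of H extends to G: the
--     only possible violation is at x or y when both have colour 3 and all
--     (at most 4) neighbours have colour 3, and then recolouring that vertex
--     with colour 4 is harmless because it has at most 4 neighbours;
--   * H is planar.  Deleting an edge from a rotation system gives a rotation
--     system of H, and a case analysis on whether the two darts of xy lie on
--     one face and whether x, y stay connected shows how V + (F + I) and
--     2C + E change (I = isolated vertices).  Together with Euler's
--     inequality V + (F + I) ≤ 2C + E for every rotation system, proved by
--     induction on the number of edges with the same case analysis, this
--     forces the Euler equality for H.
-- But numBig H ≤ numBig G and size H < size G, contradicting minimality.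

open import Defs
open import Data.Nat using (ℕ; zero; suc; _+_; _*_; _≤_; _<_; z≤n; s≤s; _≤ᵇ_; _<ᵇ_; _<?_; _≤?_)
open import Data.Nat.Properties
open import Data.Nat.DivMod using (_/_; _%_; m≡m%n+[m/n]*n; m%n<n)
open import Data.Nat.Tactic.RingSolver using (solve-∀)
open import Data.Fin using (Fin; zero; suc; toℕ; fromℕ<; punchOut; punchIn; combine; remQuot)
open import Data.Fin.Properties using (pigeonhole; any?; toℕ<n; toℕ-fromℕ<; toℕ-injective; punchOut-injective; punchOut-punchIn; punchOut-cong; punchInᵢ≢i; injective⇒≤; remQuot-combine) renaming (_≟_ to _≟F_; suc-injective to Fin-suc-injective)
open import Data.Bool using (Bool; true; false; T; _∧_; _∨_; not; if_then_else_)
open import Data.Bool.Properties using (T-∧; T-∨; ∧-zeroʳ; ∧-identityʳ)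
open import Data.Product using (Σ; _×_; _,_; ∃-syntax; proj₁; proj₂)
open import Data.Product.Properties using (,-injective; ,-injectiveˡ; ,-injectiveʳ)
import Data.Product.Properties as Product
open import Data.Sum using (_⊎_; inj₁; inj₂; [_,_])
open import Data.Empty using (⊥; ⊥-elim)
open import Data.Unit using (⊤; tt)
open import Relation.Nullary using (¬_; Dec; yes; no; does)
open import Relation.Nullary.Decidable using (T?; _×-dec_; _⊎-dec_; dec-true; dec-false)
open import Relation.Binary using (tri<; tri≈; tri>)
open import Relation.Binary.PropositionalEquality using (_≡_; _≢_; refl; trans; cong; cong₂; subst; subst₂; module ≡-Reasoning) renaming (sym to sym≡)
open import Relation.Binary.Construct.Closure.ReflexiveTransitive using (Star; ε; _◅_; _◅◅_; reverse)
import Relation.Binary.Construct.Closure.ReflexiveTransitive as Star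
open import Function using (_∘_)
open import Function.Bundles using (mk⇔; Equivalence)

∧-intro : ∀ {a b} → T a → T b → T (a ∧ b)
∧-intro p q = Equivalence.from T-∧ (p , q)

∧-elim : ∀ a {b} → T (a ∧ b) → T a × T b
∧-elim a = Equivalence.to (T-∧ {a})

∨-intro₁ : ∀ a {b} → T a → T (a ∨ b)
∨-intro₁ a p = Equivalence.from (T-∨ {a}) (inj₁ p)

∨-intro₂ : ∀ a {b} → T b → T (a ∨ b)
∨-intro₂ a p = Equivalence.from (T-∨ {a}) (inj₂ p)

∨-elim : ∀ a {b} → T (a ∨ b) → T a ⊎ T b
∨-elim a = Equivalence.to (T-∨ {a})

T⇒≡true : ∀ {b} → T b → b ≡ true
T⇒≡true {true} _ = refl

does-cong : ∀ {P Q : Set} → (P → Q) → (Q → P) → (p : Dec P) (q : Dec Q) → does p ≡ does q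
does-cong f g (yes _) (yes _) = refl
does-cong f g (no _) (no _) = refl
does-cong f g (yes p) (no ¬q) = ⊥-elim (¬q (f p))
does-cong f g (no ¬p) (yes q) = ⊥-elim (¬p (g q))

≟-refl : ∀ {n} (a : Fin n) → T (does (a ≟F a))
≟-refl a with a ≟F a
... | yes _ = tt
... | no ne = ne refl

-- Counting.  `countTrue f` is the sum of the 0/1 indicators of f, so
-- counting facts follow from elementary facts about finite sums.

indicator : Bool → ℕ
indicator b = if b then 1 else 0

countTrue-sum : ∀ {n} (f : Fin n → Bool) → countTrue f ≡ sumFin (indicator ∘ f)
countTrue-sum {zero} f = refl
countTrue-sum {suc n} f = cong (indicator (f zero) +_) (countTrue-sum (f ∘ suc))

indicator-mono : ∀ {a b : Bool} → (T a → T b) → indicator a ≤ indicator b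
indicator-mono {false} h = z≤n
indicator-mono {true} {true} h = ≤-refl
indicator-mono {true} {false} h = ⊥-elim (h tt)

sumFin-ext : ∀ {n} (f g : Fin n → ℕ) → (∀ i → f i ≡ g i) → sumFin f ≡ sumFin g
sumFin-ext {zero} f g h = refl
sumFin-ext {suc n} f g h = cong₂ _+_ (h zero) (sumFin-ext (f ∘ suc) (g ∘ suc) (h ∘ suc))

sumFin-term≤ : ∀ {n} (f : Fin n → ℕ) i → f i ≤ sumFin f
sumFin-term≤ f zero = m≤m+n _ _
sumFin-term≤ f (suc i) = ≤-trans (sumFin-term≤ (f ∘ suc) i) (m≤n+m _ _)

sumFin-pos : ∀ {n} (f : Fin n → ℕ) → 1 ≤ sumFin f → ∃[ i ] 1 ≤ f i
sumFin-pos {suc n} f p with f zero in eq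
... | suc k = zero , subst (1 ≤_) (sym≡ eq) (s≤s z≤n)
... | zero with sumFin-pos (f ∘ suc) p
... | i , q = suc i , q

sumFin-update : ∀ {n} (f g : Fin n → ℕ) (p : Fin n) → (∀ i → i ≢ p → f i ≡ g i) →
                sumFin f + g p ≡ sumFin g + f p
sumFin-update {suc n} f g zero h =
  begin
    f zero + sumFin (f ∘ suc) + g zero
  ≡⟨ cong (λ s → f zero + s + g zero) (sumFin-ext (f ∘ suc) (g ∘ suc) (λ i → h (suc i) (λ ()))) ⟩
    f zero + sumFin (g ∘ suc) + g zero
  ≡⟨ swap-ends (f zero) (sumFin (g ∘ suc)) (g zero) ⟩
    g zero + sumFin (g ∘ suc) + f zero
  ∎
  where
  open ≡-Reasoning
  swap-ends : ∀ a s b → a + s + b ≡ b + s + a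
  swap-ends = solve-∀
sumFin-update {suc n} f g (suc p) h =
  begin
    f zero + sumFin (f ∘ suc) + g (suc p)
  ≡⟨ +-assoc (f zero) _ _ ⟩
    f zero + (sumFin (f ∘ suc) + g (suc p))
  ≡⟨ cong₂ _+_ (h zero (λ ())) (sumFin-update (f ∘ suc) (g ∘ suc) p (λ i ne → h (suc i) (ne ∘ Fin-suc-injective))) ⟩
    g zero + (sumFin (g ∘ suc) + f (suc p))
  ≡⟨ +-assoc (g zero) _ _ ⟨
    g zero + sumFin (g ∘ suc) + f (suc p)
  ∎
  where open ≡-Reasoning

count-ext : ∀ {n} (f g : Fin n → Bool) → (∀ i → f i ≡ g i) → countTrue f ≡ countTrue g
count-ext {zero} f g h = refl
count-ext {suc n} f g h = cong₂ _+_ (cong indicator (h zero)) (count-ext (f ∘ suc) (g ∘ suc) (h ∘ suc))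

count-update : ∀ {n} (f g : Fin n → Bool) (p : Fin n) → (∀ i → i ≢ p → f i ≡ g i) →
               countTrue f + indicator (g p) ≡ countTrue g + indicator (f p)
count-update f g p h =
  begin
    countTrue f + indicator (g p)
  ≡⟨ cong (_+ indicator (g p)) (countTrue-sum f) ⟩
    sumFin (indicator ∘ f) + indicator (g p)
  ≡⟨ sumFin-update (indicator ∘ f) (indicator ∘ g) p (λ i ne → cong indicator (h i ne)) ⟩
    sumFin (indicator ∘ g) + indicator (f p)
  ≡⟨ cong (_+ indicator (f p)) (countTrue-sum g) ⟨
    countTrue g + indicator (f p)
  ∎
  where open ≡-Reasoning

+-swapʳ : ∀ a b c → a + b + c ≡ a + c + b
+-swapʳ = solve-∀

count-update₂ : ∀ {n} (f g : Fin n → Bool) p q → p ≢ q → (∀ i → i ≢ p → i ≢ q → f i ≡ g i) →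
                countTrue f + indicator (g p) + indicator (g q) ≡ countTrue g + indicator (f p) + indicator (f q)
count-update₂ {n} f g p q p≢q same =
  begin
    countTrue f + indicator (g p) + indicator (g q)
  ≡⟨ cong (λ b → countTrue f + indicator b + indicator (g q)) (sym≡ h-p) ⟩
    countTrue f + indicator (h p) + indicator (g q)
  ≡⟨ cong (_+ indicator (g q)) (count-update f h p (λ i i≢p → sym≡ (h-other i i≢p))) ⟩
    countTrue h + indicator (f p) + indicator (g q)
  ≡⟨ +-swapʳ (countTrue h) _ _ ⟩
    countTrue h + indicator (g q) + indicator (f p)
  ≡⟨ cong (_+ indicator (f p)) (count-update h g q h≈g) ⟩
    countTrue g + indicator (h q) + indicator (f p)
  ≡⟨ cong (λ b → countTrue g + indicator b + indicator (f p)) (h-other q (p≢q ∘ sym≡)) ⟩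
    countTrue g + indicator (f q) + indicator (f p)
  ≡⟨ +-swapʳ (countTrue g) _ _ ⟩
    countTrue g + indicator (f p) + indicator (f q)
  ∎
  where
  open ≡-Reasoning
  h : Fin n → Bool
  h i = if does (i ≟F p) then g p else f i
  h-p : h p ≡ g p
  h-p with p ≟F p
  ... | yes _ = refl
  ... | no ne = ⊥-elim (ne refl)
  h-other : ∀ i → i ≢ p → h i ≡ f i
  h-other i i≢p with i ≟F p
  ... | yes e = ⊥-elim (i≢p e)
  ... | no _ = refl
  h≈g : ∀ i → i ≢ q → h i ≡ g i
  h≈g i i≢q with i ≟F p
  ... | yes refl = refl
  ... | no i≢p = same i i≢p i≢q

count-mono : ∀ {n} (f g : Fin n → Bool) → (∀ i → T (f i) → T (g i)) → countTrue f ≤ countTrue g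
count-mono {zero} f g h = z≤n
count-mono {suc n} f g h = +-mono-≤ (indicator-mono (h zero)) (count-mono (f ∘ suc) (g ∘ suc) (h ∘ suc))

count-strict : ∀ {n} (f g : Fin n → Bool) → (∀ i → T (f i) → T (g i)) → ∀ p → T (g p) → ¬ T (f p) →
               suc (countTrue f) ≤ countTrue g
count-strict {suc n} f g h zero gp ¬fp with f zero | g zero
... | true | _ = ⊥-elim (¬fp tt)
... | false | true = s≤s (count-mono (f ∘ suc) (g ∘ suc) (h ∘ suc))
count-strict {suc n} f g h (suc p) gp ¬fp =
  ≤-trans (≤-reflexive (sym≡ (+-suc (indicator (f zero)) _)))
    (+-mono-≤ (indicator-mono (h zero)) (count-strict (f ∘ suc) (g ∘ suc) (h ∘ suc) p gp ¬fp))

count-≤-reflects : ∀ {n} (f g : Fin n → Bool) → (∀ i → T (f i) → T (g i)) → countTrue g ≤ countTrue f →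
                   ∀ i → T (g i) → T (f i)
count-≤-reflects f g h le i gi with f i in eq
... | true = tt
... | false = ⊥-elim (<⇒≱ (count-strict f g h i gi (λ fi → subst T eq fi)) le)

count-≤n : ∀ {n} (f : Fin n → Bool) → countTrue f ≤ n
count-≤n {zero} f = z≤n
count-≤n {suc n} f = +-mono-≤ (indicator≤1 (f zero)) (count-≤n (f ∘ suc))
  where
  indicator≤1 : ∀ b → indicator b ≤ 1
  indicator≤1 true = ≤-refl
  indicator≤1 false = z≤n

count-pos : ∀ {n} (f : Fin n → Bool) i → T (f i) → 1 ≤ countTrue f
count-pos f i p = ≤-trans (≤-reflexive (cong indicator (sym≡ (T⇒≡true p))))
                          (≤-trans (sumFin-term≤ (indicator ∘ f) i) (≤-reflexive (sym≡ (countTrue-sum f))))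

count-exists : ∀ {n} (f : Fin n → Bool) → 1 ≤ countTrue f → ∃[ i ] T (f i)
count-exists f p with sumFin-pos (indicator ∘ f) (subst (1 ≤_) (countTrue-sum f) p)
... | i , q with f i in eq
... | true = i , subst T (sym≡ eq) tt

count-false : ∀ {n} → countTrue {n} (λ _ → false) ≡ 0
count-false {zero} = refl
count-false {suc n} = count-false {n}

count-true : ∀ {n} → countTrue {n} (λ _ → true) ≡ n
count-true {zero} = refl
count-true {suc n} = cong suc (count-true {n})

count-singleton : ∀ {n} (y : Fin n) → countTrue (λ w → does (w ≟F y)) ≡ 1
count-singleton {n} y with count-update (λ _ → false) (λ w → does (w ≟F y)) y (λ i ne → sym≡ (not-y i ne))
  where
  not-y : ∀ i → i ≢ y → does (i ≟F y) ≡ false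
  not-y i ne with i ≟F y
  ... | yes e = ⊥-elim (ne e)
  ... | no _ = refl
... | e rewrite count-false {n} with y ≟F y
... | yes _ = sym≡ (trans e (+-identityʳ _))
... | no ne = ⊥-elim (ne refl)

count-≥2 : ∀ {n} (f : Fin n → Bool) i j → T (f i) → T (f j) → i ≢ j → 2 ≤ countTrue f
count-≥2 {n} f i j fi fj i≢j =
  ≤-trans (s≤s (count-pos f-i j (∧-intro fj (not-i j (i≢j ∘ sym≡)))))
          (count-strict f-i f (λ w p → proj₁ (∧-elim (f w) p)) i fi (λ p → not-i-false (proj₂ (∧-elim (f i) p))))
  where
  f-i : Fin n → Bool
  f-i w = f w ∧ not (does (w ≟F i))
  not-i : ∀ w → w ≢ i → T (not (does (w ≟F i)))
  not-i w ne with w ≟F i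
  ... | yes e = ne e
  ... | no _ = tt
  not-i-false : ¬ T (not (does (i ≟F i)))
  not-i-false with i ≟F i
  ... | no ne = ⊥-elim (ne refl)

iter-+ : ∀ {A : Set} (f : A → A) a m k → iter f a (k + m) ≡ iter f (iter f a m) k
iter-+ f a m zero = refl
iter-+ f a m (suc k) = cong f (iter-+ f a m k)

iter-suc-inner : ∀ {A : Set} (f : A → A) a k → iter f a (suc k) ≡ iter f (f a) k
iter-suc-inner f a k = trans (cong (iter f a) (+-comm 1 k)) (iter-+ f a 1 k)

iter-preserves : ∀ {A : Set} (P : A → Set) (f : A → A) → (∀ a → P a → P (f a)) → ∀ a k → P a → P (iter f a k)
iter-preserves P f h a zero p = p
iter-preserves P f h a (suc k) p = h _ (iter-preserves P f h a k p)

iter-fixed : ∀ {A : Set} (f : A → A) a → f a ≡ a → ∀ k → iter f a k ≡ a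
iter-fixed f a e zero = refl
iter-fixed f a e (suc k) = trans (cong f (iter-fixed f a e k)) e

iter-periodic : ∀ {A : Set} (f : A → A) a q → iter f a q ≡ a → ∀ m → iter f a (m * q) ≡ a
iter-periodic f a q e zero = refl
iter-periodic f a q e (suc m) =
  trans (iter-+ f a (m * q) q) (trans (cong (λ z → iter f z q) (iter-periodic f a q e m)) e)

iter-mod : ∀ {A : Set} (f : A → A) a p → iter f a (suc p) ≡ a → ∀ k → iter f a k ≡ iter f a (k % suc p)
iter-mod f a p per k =
  begin
    iter f a k
  ≡⟨ cong (iter f a) (m≡m%n+[m/n]*n k (suc p)) ⟩
    iter f a (k % suc p + (k / suc p) * suc p)
  ≡⟨ iter-+ f a _ (k % suc p) ⟩
    iter f (iter f a ((k / suc p) * suc p)) (k % suc p)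
  ≡⟨ cong (λ z → iter f z (k % suc p)) (iter-periodic f a (suc p) per (k / suc p)) ⟩
    iter f a (k % suc p)
  ∎
  where open ≡-Reasoning

orbit-avoid : ∀ {A : Set} (f : A → A) a b p → iter f a (suc p) ≡ a → (∀ j → j ≤ p → iter f a j ≢ b) →
              ∀ k → iter f a k ≢ b
orbit-avoid f a b p per h k e = h (k % suc p) (≤-pred (m%n<n k (suc p))) (trans (sym≡ (iter-mod f a p per k)) e)

orbit-trans : ∀ {A : Set} (f : A → A) a b c → ∃[ k ] iter f a k ≡ b → ∃[ k ] iter f b k ≡ c → ∃[ k ] iter f a k ≡ c
orbit-trans f a b c (k , e) (k' , e') = k' + k , trans (iter-+ f a k k') (trans (cong (λ z → iter f z k') e) e')

least : ∀ (P : ℕ → Set) → (∀ n → Dec (P n)) → ∀ k → P k → ∃[ m ] P m × (∀ j → j < m → ¬ P j)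
least P P? k pk with search (suc k)
  where
  search : ∀ k → (∀ j → j < k → ¬ P j) ⊎ (∃[ m ] P m × (∀ j → j < m → ¬ P j))
  search zero = inj₁ (λ j ())
  search (suc k) with search k
  ... | inj₂ found = inj₂ found
  ... | inj₁ below with P? k
  ... | yes pk = inj₂ (k , pk , below)
  ... | no ¬pk = inj₁ λ j j<sk pj → case (m≤n⇒m<n∨m≡n (≤-pred j<sk)) pj
    where
    case : ∀ {j} → j < k ⊎ j ≡ k → P j → ⊥
    case (inj₁ lt) pj = below _ lt pj
    case (inj₂ refl) pj = ¬pk pj
... | inj₁ below = ⊥-elim (below k ≤-refl pk)
... | inj₂ found = found

module FiniteOrbits {A : Set} {N : ℕ} (enc : A → Fin N) (enc-inj : ∀ {a b} → enc a ≡ enc b → a ≡ b)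
                    (f : A → A) where

  -- By pigeonhole, some iterate recurs within the first N + 1 steps.
  collision : ∀ a → ∃[ i ] ∃[ d ] suc (i + d) ≤ N × iter f a i ≡ iter f a (suc (i + d))
  collision a with pigeonhole ≤-refl (λ (i : Fin (suc N)) → enc (iter f a (toℕ i)))
  ... | i , j , i<j , e with m≤n⇒∃[o]m+o≡n i<j
  ... | d , i+d≡j = toℕ i , d , subst (_≤ N) (sym≡ i+d≡j) (≤-pred (toℕ<n j)) ,
                     subst (λ m → iter f a (toℕ i) ≡ iter f a m) (sym≡ i+d≡j) (enc-inj e)

  orbit-bounded : ∀ a b k → iter f a k ≡ b → ∃[ k' ] k' < N × iter f a k' ≡ b
  orbit-bounded a b k e with collision a
  ... | i , d , i+d<N , ce with k <? i
  ...   | yes k<i = k , <-trans k<i (≤-<-trans (m≤m+n i d) i+d<N) , e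
  ...   | no k≮i with m≤n⇒∃[o]m+o≡n (≮⇒≥ k≮i)
  ...     | o , refl = o % suc d + i , <-≤-trans (+-monoˡ-< i (m%n<n o (suc d))) (subst (_≤ N) (cong suc (+-comm i d)) i+d<N) , trans reach e
    where
    c : A
    c = iter f a i
    c-periodic : iter f c (suc d) ≡ c
    c-periodic = trans (sym≡ (iter-+ f a i (suc d))) (trans (cong (λ m → iter f a (suc m)) (+-comm d i)) (sym≡ ce))
    reach : iter f a (o % suc d + i) ≡ iter f a (i + o)
    reach = trans (iter-+ f a i (o % suc d)) (trans (sym≡ (iter-mod f c d c-periodic o)) (trans (sym≡ (iter-+ f a i o)) (cong (iter f a) (+-comm o i))))

  orbit? : ((a b : A) → Dec (a ≡ b)) → ∀ a b → Dec (∃[ k ] iter f a k ≡ b)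
  orbit? _≟_ a b with any? (λ (k : Fin N) → iter f a (toℕ k) ≟ b)
  ... | yes (k , e) = yes (toℕ k , e)
  ... | no none = no λ { (k , e) → let (k' , lt , e') = orbit-bounded a b k e in
                         none (fromℕ< lt , subst (λ z → iter f a z ≡ b) (sym≡ (toℕ-fromℕ< lt)) e') }

  -- If f is injective on an invariant set D, orbits in D are cycles, so
  -- "lies on the orbit of" is symmetric there.
  module Injective (D : A → Set) (D-closed : ∀ a → D a → D (f a))
                   (f-inj : ∀ a b → D a → D b → f a ≡ f b → a ≡ b) where

    cancel : ∀ u v i → D u → D v → iter f u i ≡ iter f v i → u ≡ v
    cancel u v zero du dv e = e
    cancel u v (suc i) du dv e =
      cancel u v i du dv (f-inj _ _ (iter-preserves D f D-closed u i du) (iter-preserves D f D-closed v i dv) e)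

    period : ∀ a → D a → ∃[ p ] iter f a (suc p) ≡ a
    period a da with collision a
    ... | i , d , _ , ce = d , sym≡ (cancel a (iter f a (suc d)) i da (iter-preserves D f D-closed a (suc d) da)
                                      (trans ce (trans (cong (iter f a) (sym≡ (+-suc i d))) (iter-+ f a (suc d) i))))

    orbit-sym : ∀ a b k → D a → iter f a k ≡ b → ∃[ k' ] iter f b k' ≡ a
    orbit-sym a b k da e with period a da
    ... | p , per = k * p ,
      (begin
        iter f b (k * p)                ≡⟨ cong (λ z → iter f z (k * p)) (sym≡ e) ⟩
        iter f (iter f a k) (k * p)     ≡⟨ iter-+ f a k (k * p) ⟨
        iter f a (k * p + k)            ≡⟨ cong (iter f a) (trans (+-comm (k * p) k) (sym≡ (*-suc k p))) ⟩
        iter f a (k * suc p)            ≡⟨ iter-periodic f a (suc p) per k ⟩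
        a                               ∎)
      where open ≡-Reasoning

-- Counting equivalence classes.  `Classes D R F` is a labelling of the
-- elements satisfying D by Fin F that is surjective and identifies exactly
-- the R-related elements; it witnesses that D has F classes under R.  Faces
-- (orbits of the face permutation on darts) and connected components are
-- counted this way in `PlanarEmbedding`.

record Classes {A : Set} (D : A → Set) (R : A → A → Set) (F : ℕ) : Set where
  field
    lab  : Σ A D → Fin F
    lab-sound : ∀ d d' → lab d ≡ lab d' → R (proj₁ d) (proj₁ d')
    lab-complete : ∀ d d' → R (proj₁ d) (proj₁ d') → lab d ≡ lab d'
    lab-onto : ∀ c → ∃[ d ] lab d ≡ c
open Classes

lab-irr : ∀ {A : Set} {D : A → Set} {R : A → A → Set} {F} (cl : Classes D R F) →
          ∀ a (p q : D a) → lab cl (a , p) ≡ lab cl (a , q)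
lab-irr cl a p q = lab-complete cl (a , p) (a , q) (lab-sound cl (a , p) (a , p) refl)

classes-transport : ∀ {A : Set} {D1 D2 : A → Set} {R1 R2 : A → A → Set} {F} →
  Classes D1 R1 F → (∀ a → D2 a → D1 a) → (∀ a → D1 a → D2 a) →
  (∀ a b → D2 a → D2 b → R1 a b → R2 a b) → (∀ a b → D2 a → D2 b → R2 a b → R1 a b) →
  Classes D2 R2 F
classes-transport {D1 = D1} {D2} {R1} {R2} cl f g h1 h2 = record
  { lab = λ { (a , p) → lab cl (a , f a p) }
  ; lab-sound = λ { (a , p) (b , q) e → h1 a b p q (lab-sound cl (a , f a p) (b , f b q) e) }
  ; lab-complete = λ { (a , p) (b , q) r → lab-complete cl (a , f a p) (b , f b q) (h2 a b p q r) }
  ; lab-onto = λ c → let ((a , p) , e) = lab-onto cl c in (a , g a p) , trans (lab-irr cl a _ _) e }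

classes-≤ : ∀ {A : Set} {D : A → Set} {R1 R2 : A → A → Set} {F1 F2} →
  Classes D R1 F1 → Classes D R2 F2 → (∀ a b → D a → D b → R2 a b → R1 a b) → F1 ≤ F2
classes-≤ {D = D} {R1} {R2} {F1} {F2} c1 c2 h = injective⇒≤ {f = g} inj
  where
  pick : Fin F1 → Σ _ D
  pick c = proj₁ (lab-onto c1 c)
  g : Fin F1 → Fin F2
  g c = lab c2 (pick c)
  inj : ∀ {c c'} → g c ≡ g c' → c ≡ c'
  inj {c} {c'} e = trans (sym≡ (proj₂ (lab-onto c1 c)))
    (trans (lab-complete c1 (pick c) (pick c') (h _ _ (proj₂ (pick c)) (proj₂ (pick c')) (lab-sound c2 (pick c) (pick c') e)))
      (proj₂ (lab-onto c1 c')))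

classes-unique : ∀ {A : Set} {D : A → Set} {R1 R2 : A → A → Set} {F1 F2} →
  Classes D R1 F1 → Classes D R2 F2 → (∀ a b → D a → D b → R2 a b → R1 a b) →
  (∀ a b → D a → D b → R1 a b → R2 a b) → F1 ≡ F2
classes-unique c1 c2 h1 h2 = ≤-antisym (classes-≤ c1 c2 h1) (classes-≤ c2 c1 h2)

Merge : ∀ {A : Set} → (A → A → Set) → A → A → A → A → Set
Merge R a b d d' = R d d' ⊎ (R d a × R d' b) ⊎ (R d b × R d' a)

module Collapse {F : ℕ} (α β : Fin (suc F)) (α≢β : α ≢ β) where
  redirect : Fin (suc F) → Fin (suc F)
  redirect c with c ≟F β
  ... | yes _ = α
  ... | no _ = c
  redirect≢ : ∀ c → β ≢ redirect c
  redirect≢ c with c ≟F β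
  ... | yes _ = λ e → α≢β (sym≡ e)
  ... | no ne = λ e → ne (sym≡ e)
  glue : Fin (suc F) → Fin F
  glue c = punchOut (redirect≢ c)
  redirect-α : redirect α ≡ α
  redirect-α with α ≟F β
  ... | yes e = ⊥-elim (α≢β e)
  ... | no _ = refl
  redirect-β : redirect β ≡ α
  redirect-β with β ≟F β
  ... | yes _ = refl
  ... | no ne = ⊥-elim (ne refl)
  glue-αβ : glue α ≡ glue β
  glue-αβ = punchOut-cong β (trans redirect-α (sym≡ redirect-β))
  glue-inv : ∀ c c' → glue c ≡ glue c' → c ≡ c' ⊎ (c ≡ α × c' ≡ β) ⊎ (c ≡ β × c' ≡ α)
  glue-inv c c' e with punchOut-injective (redirect≢ c) (redirect≢ c') e
  ... | e2 with c ≟F β | c' ≟F β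
  ... | yes p | yes q = inj₁ (trans p (sym≡ q))
  ... | yes p | no q = inj₂ (inj₂ (p , sym≡ e2))
  ... | no p | yes q = inj₂ (inj₁ (e2 , q))
  ... | no p | no q = inj₁ e2
  glue-onto : ∀ c' → ∃[ c ] glue c ≡ c'
  glue-onto c' = punchIn β c' , trans (punchOut-cong β (redirect-ne (punchIn β c') (λ e → punchInᵢ≢i β c' e))) (punchOut-punchIn β)
    where
    redirect-ne : ∀ c → c ≢ β → redirect c ≡ c
    redirect-ne c ne with c ≟F β
    ... | yes e = ⊥-elim (ne e)
    ... | no _ = refl

classes-merge : ∀ {A : Set} {D : A → Set} {R : A → A → Set} {F} →
  Classes D R (suc F) → ∀ a b → (pa : D a) → (pb : D b) → ¬ R a b → Classes D (Merge R a b) F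
classes-merge {A} {D} {R} {F} cl a b pa pb nab = record
  { lab = λ d → glue (lab cl d)
  ; lab-sound = λ d d' e → to d d' (glue-inv _ _ e)
  ; lab-complete = from
  ; lab-onto = λ c' → let (c , e) = glue-onto c' ; (d , e') = lab-onto cl c in d , trans (cong glue e') e }
  where
  α β : Fin (suc F)
  α = lab cl (a , pa)
  β = lab cl (b , pb)
  open Collapse α β (λ e → nab (lab-sound cl (a , pa) (b , pb) e))
  to : ∀ d d' → lab cl d ≡ lab cl d' ⊎ (lab cl d ≡ α × lab cl d' ≡ β) ⊎ (lab cl d ≡ β × lab cl d' ≡ α) →
       Merge R a b (proj₁ d) (proj₁ d')
  to d d' (inj₁ e) = inj₁ (lab-sound cl d d' e)
  to d d' (inj₂ (inj₁ (e1 , e2))) = inj₂ (inj₁ (lab-sound cl d (a , pa) e1 , lab-sound cl d' (b , pb) e2))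
  to d d' (inj₂ (inj₂ (e1 , e2))) = inj₂ (inj₂ (lab-sound cl d (b , pb) e1 , lab-sound cl d' (a , pa) e2))
  from : ∀ d d' → Merge R a b (proj₁ d) (proj₁ d') → glue (lab cl d) ≡ glue (lab cl d')
  from d d' (inj₁ r) = cong glue (lab-complete cl d d' r)
  from d d' (inj₂ (inj₁ (r1 , r2))) = trans (cong glue (lab-complete cl d (a , pa) r1)) (trans glue-αβ (cong glue (sym≡ (lab-complete cl d' (b , pb) r2))))
  from d d' (inj₂ (inj₂ (r1 , r2))) = trans (cong glue (lab-complete cl d (b , pb) r1)) (trans (sym≡ glue-αβ) (cong glue (sym≡ (lab-complete cl d' (a , pa) r2))))

classes-remove-nonsingleton : ∀ {A : Set} {D : A → Set} {R : A → A → Set} {F} → ((a b : A) → Dec (a ≡ b)) →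
  Classes D R F → ∀ e → D e → (w : A) → D w → w ≢ e → R w e → Classes (λ a → D a × a ≢ e) R F
classes-remove-nonsingleton {A} {D} {R} {F} dec cl e pe w pw wne rwe = record
  { lab = λ { (a , p , _) → lab cl (a , p) }
  ; lab-sound = λ { (a , p , _) (b , q , _) r → lab-sound cl (a , p) (b , q) r }
  ; lab-complete = λ { (a , p , _) (b , q , _) r → lab-complete cl (a , p) (b , q) r }
  ; lab-onto = onto }
  where
  onto : ∀ c → ∃[ d ] lab cl (proj₁ d , proj₁ (proj₂ d)) ≡ c
  onto c with lab-onto cl c
  ... | (a , p) , eq with dec a e
  ... | no ne = (a , p , ne) , eq
  ... | yes refl = (w , pw , wne) , trans (lab-complete cl (w , pw) (a , p) rwe) eq

classes-remove-singleton : ∀ {A : Set} {D : A → Set} {R : A → A → Set} {F} →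
  Classes D R (suc F) → ∀ e → (pe : D e) → (∀ a → D a → R a e → a ≡ e) → Classes (λ a → D a × a ≢ e) R F
classes-remove-singleton {A} {D} {R} {F} cl e pe sing = record
  { lab = λ { (a , p , ne) → punchOut (nl a p ne) }
  ; lab-sound = λ { (a , p , ne) (b , q , ne') eq → lab-sound cl (a , p) (b , q) (punchOut-injective (nl a p ne) (nl b q ne') eq) }
  ; lab-complete = λ { (a , p , ne) (b , q , ne') r → punchOut-cong (lab cl (e , pe)) (lab-complete cl (a , p) (b , q) r) }
  ; lab-onto = onto }
  where
  nl : ∀ a (p : D a) → a ≢ e → lab cl (e , pe) ≢ lab cl (a , p)
  nl a p ne eq = ne (sing a p (lab-sound cl (a , p) (e , pe) (sym≡ eq)))
  onto : ∀ c → ∃[ d ] punchOut (nl (proj₁ d) (proj₁ (proj₂ d)) (proj₂ (proj₂ d))) ≡ c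
  onto c with lab-onto cl (punchIn (lab cl (e , pe)) c)
  ... | (a , p) , eq = (a , p , ne) , trans (punchOut-cong (lab cl (e , pe)) eq) (punchOut-punchIn (lab cl (e , pe)))
    where
    ne : a ≢ e
    ne refl = punchInᵢ≢i (lab cl (e , pe)) c (trans (sym≡ eq) (lab-irr cl e p pe))

classes-exist-Fin : ∀ N (D : Fin N → Set) (R : Fin N → Fin N → Set) →
  (∀ i → Dec (D i)) → (∀ i j → Dec (R i j)) →
  (∀ i → D i → R i i) → (∀ i j → D i → D j → R i j → R j i) →
  (∀ i j k → D i → D j → D k → R i j → R j k → R i k) → Σ ℕ (Classes D R)
classes-exist-Fin zero D R dD dR rf sy tr = 0 , record
  { lab = λ { (() , _) } ; lab-sound = λ { (() , _) } ; lab-complete = λ { (() , _) } ; lab-onto = λ () }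
classes-exist-Fin (suc N) D R dD dR rf sy tr with classes-exist-Fin N (D ∘ suc) (λ i j → R (suc i) (suc j)) (dD ∘ suc) (λ i j → dR (suc i) (suc j))
      (λ i → rf (suc i)) (λ i j → sy (suc i) (suc j)) (λ i j k → tr (suc i) (suc j) (suc k))
... | F , cl with dD zero
... | no nd = F , record
  { lab = lb ; lab-sound = sound ; lab-complete = complete ; lab-onto = λ c → let ((i , p) , e) = lab-onto cl c in (suc i , p) , e }
  where
  lb : Σ (Fin (suc N)) D → Fin F
  lb (zero , p) = ⊥-elim (nd p)
  lb (suc i , p) = lab cl (i , p)
  sound : ∀ d d' → lb d ≡ lb d' → R (proj₁ d) (proj₁ d')
  sound (zero , p) _ = ⊥-elim (nd p)
  sound (suc i , p) (zero , q) = ⊥-elim (nd q)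
  sound (suc i , p) (suc j , q) e = lab-sound cl (i , p) (j , q) e
  complete : ∀ d d' → R (proj₁ d) (proj₁ d') → lb d ≡ lb d'
  complete (zero , p) _ = ⊥-elim (nd p)
  complete (suc i , p) (zero , q) = ⊥-elim (nd q)
  complete (suc i , p) (suc j , q) r = lab-complete cl (i , p) (j , q) r
... | yes p0 with any? (λ j → dD (suc j) ×-dec dR zero (suc j))
... | yes (j , dj , r0) = F , record
  { lab = lb ; lab-sound = sound ; lab-complete = complete ; lab-onto = λ c → let ((i , p) , e) = lab-onto cl c in (suc i , p) , e }
  where
  lb : Σ (Fin (suc N)) D → Fin F
  lb (zero , p) = lab cl (j , dj)
  lb (suc i , p) = lab cl (i , p)
  sound : ∀ d d' → lb d ≡ lb d' → R (proj₁ d) (proj₁ d')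
  sound (zero , p) (zero , q) e = rf zero p
  sound (zero , p) (suc i , q) e = tr _ _ _ p dj q r0 (lab-sound cl (j , dj) (i , q) e)
  sound (suc i , p) (zero , q) e = sy _ _ q p (tr _ _ _ q dj p r0 (lab-sound cl (j , dj) (i , p) (sym≡ e)))
  sound (suc i , p) (suc k , q) e = lab-sound cl (i , p) (k , q) e
  complete : ∀ d d' → R (proj₁ d) (proj₁ d') → lb d ≡ lb d'
  complete (zero , p) (zero , q) r = refl
  complete (zero , p) (suc i , q) r = lab-complete cl (j , dj) (i , q) (tr _ _ _ dj p q (sy _ _ p dj r0) r)
  complete (suc i , p) (zero , q) r = lab-complete cl (i , p) (j , dj) (tr _ _ _ p q dj r r0)
  complete (suc i , p) (suc k , q) r = lab-complete cl (i , p) (k , q) r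
... | no nj = suc F , record
  { lab = lb ; lab-sound = sound ; lab-complete = complete ; lab-onto = onto }
  where
  lb : Σ (Fin (suc N)) D → Fin (suc F)
  lb (zero , p) = zero
  lb (suc i , p) = suc (lab cl (i , p))
  sound : ∀ d d' → lb d ≡ lb d' → R (proj₁ d) (proj₁ d')
  sound (zero , p) (zero , q) e = rf zero p
  sound (zero , p) (suc i , q) ()
  sound (suc i , p) (zero , q) ()
  sound (suc i , p) (suc k , q) e = lab-sound cl (i , p) (k , q) (Fin-suc-injective e)
  complete : ∀ d d' → R (proj₁ d) (proj₁ d') → lb d ≡ lb d'
  complete (zero , p) (zero , q) r = refl
  complete (zero , p) (suc i , q) r = ⊥-elim (nj (i , q , r))
  complete (suc i , p) (zero , q) r = ⊥-elim (nj (i , p , sy _ _ p q r))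
  complete (suc i , p) (suc k , q) r = cong suc (lab-complete cl (i , p) (k , q) r)
  onto : ∀ c → ∃[ d ] lb d ≡ c
  onto zero = (zero , p0) , refl
  onto (suc c) = let ((i , p) , e) = lab-onto cl c in (suc i , p) , cong suc e

classes-exist : ∀ {A : Set} N (enc : A → Fin N) (dec : Fin N → A) → (∀ a → dec (enc a) ≡ a) →
  (D : A → Set) (R : A → A → Set) →
  (∀ a → Dec (D a)) → (∀ a b → Dec (R a b)) →
  (∀ a → D a → R a a) → (∀ a b → D a → D b → R a b → R b a) →
  (∀ a b c → D a → D b → D c → R a b → R b c → R a c) → Σ ℕ (Classes D R)
classes-exist {A} N enc dec de D R dD dR rf sy tr with classes-exist-Fin N (D ∘ dec) (λ i j → R (dec i) (dec j)) (dD ∘ dec) (λ i j → dR (dec i) (dec j))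
    (λ i → rf (dec i)) (λ i j → sy (dec i) (dec j)) (λ i j k → tr (dec i) (dec j) (dec k))
... | F , cl = F , record
  { lab = λ { (a , p) → lab cl (enc a , subst D (sym≡ (de a)) p) }
  ; lab-sound = λ { (a , p) (b , q) e → subst₂ R (de a) (de b) (lab-sound cl (enc a , _) (enc b , _) e) }
  ; lab-complete = λ { (a , p) (b , q) r → lab-complete cl (enc a , _) (enc b , _) (subst₂ R (sym≡ (de a)) (sym≡ (de b)) r) }
  ; lab-onto = λ c → let ((i , p) , e) = lab-onto cl c in (dec i , p) ,
       trans (lab-complete cl (enc (dec i) , _) (i , p) (subst (λ z → R z (dec i)) (sym≡ (de (dec i))) (rf (dec i) p))) e }

module MergeClosure {A : Set} (D : A → Set) (R : A → A → Set)
  (rf : ∀ a → D a → R a a) (sy : ∀ a b → D a → D b → R a b → R b a)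
  (tr : ∀ a b c → D a → D b → D c → R a b → R b c → R a c)
  (a b : A) (Da : D a) (Db : D b) where

  M : A → A → Set
  M = Merge R a b

  merge-refl : ∀ d → D d → M d d
  merge-refl d p = inj₁ (rf d p)

  merge-sym : ∀ d d' → D d → D d' → M d d' → M d' d
  merge-sym d d' p q (inj₁ r) = inj₁ (sy d d' p q r)
  merge-sym d d' p q (inj₂ (inj₁ (r1 , r2))) = inj₂ (inj₂ (r2 , r1))
  merge-sym d d' p q (inj₂ (inj₂ (r1 , r2))) = inj₂ (inj₁ (r2 , r1))

  merge-trans : ∀ d d' d'' → D d → D d' → D d'' → M d d' → M d' d'' → M d d''
  merge-trans d d' d'' p q s (inj₁ r) (inj₁ r') = inj₁ (tr _ _ _ p q s r r')
  merge-trans d d' d'' p q s (inj₁ r) (inj₂ (inj₁ (r1 , r2))) = inj₂ (inj₁ (tr _ _ _ p q Da r r1 , r2))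
  merge-trans d d' d'' p q s (inj₁ r) (inj₂ (inj₂ (r1 , r2))) = inj₂ (inj₂ (tr _ _ _ p q Db r r1 , r2))
  merge-trans d d' d'' p q s (inj₂ (inj₁ (r1 , r2))) (inj₁ r) = inj₂ (inj₁ (r1 , tr _ _ _ s q Db (sy _ _ q s r) r2))
  merge-trans d d' d'' p q s (inj₂ (inj₁ (r1 , r2))) (inj₂ (inj₁ (r1' , r2'))) = inj₂ (inj₁ (r1 , r2'))
  merge-trans d d' d'' p q s (inj₂ (inj₁ (r1 , r2))) (inj₂ (inj₂ (r1' , r2'))) = inj₁ (tr _ _ _ p Da s r1 (sy _ _ s Da r2'))
  merge-trans d d' d'' p q s (inj₂ (inj₂ (r1 , r2))) (inj₁ r) = inj₂ (inj₂ (r1 , tr _ _ _ s q Da (sy _ _ q s r) r2))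
  merge-trans d d' d'' p q s (inj₂ (inj₂ (r1 , r2))) (inj₂ (inj₁ (r1' , r2'))) = inj₁ (tr _ _ _ p Db s r1 (sy _ _ s Db r2'))
  merge-trans d d' d'' p q s (inj₂ (inj₂ (r1 , r2))) (inj₂ (inj₂ (r1' , r2'))) = inj₂ (inj₂ (r1 , r2'))

  merge-collapse : R a b → ∀ d d' → D d → D d' → M d d' → R d d'
  merge-collapse rab d d' p q (inj₁ r) = r
  merge-collapse rab d d' p q (inj₂ (inj₁ (r1 , r2))) = tr _ _ _ p Db q (tr _ _ _ p Da Db r1 rab) (sy _ _ q Db r2)
  merge-collapse rab d d' p q (inj₂ (inj₂ (r1 , r2))) = tr _ _ _ p Da q (tr _ _ _ p Db Da r1 (sy _ _ Da Db rab)) (sy _ _ q Da r2)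

  merge-lift : ∀ (R' : A → A → Set) → (∀ d d' → D d → D d' → R' d d' → M d d') →
    ∀ d d' → D d → D d' → Merge R' a b d d' → M d d'
  merge-lift R' h d d' p q (inj₁ r) = h d d' p q r
  merge-lift R' h d d' p q (inj₂ (inj₁ (r1 , r2))) =
    merge-trans _ _ _ p Da q (h d a p Da r1) (merge-trans _ _ _ Da Db q (inj₂ (inj₁ (rf a Da , rf b Db))) (merge-sym _ _ q Db (h d' b q Db r2)))
  merge-lift R' h d d' p q (inj₂ (inj₂ (r1 , r2))) =
    merge-trans _ _ _ p Db q (h d b p Db r1) (merge-trans _ _ _ Db Da q (inj₂ (inj₂ (rf b Db , rf a Da))) (merge-sym _ _ q Da (h d' a q Da r2)))

  merge-orbit : ∀ (f : A → A) → (∀ c → D c → D (f c)) → (∀ c → D c → M c (f c)) →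
    ∀ d k → D d → M d (iter f d k)
  merge-orbit f fD h d zero p = merge-refl d p
  merge-orbit f fD h d (suc k) p = merge-trans _ _ _ p (iter-preserves D f fD d k p) (fD _ (iter-preserves D f fD d k p))
                                  (merge-orbit f fD h d k p) (h _ (iter-preserves D f fD d k p))

classes-nonempty : ∀ {A : Set} {D : A → Set} {R : A → A → Set} {F} → Classes D R F → ∀ a → D a → ∃[ F' ] F ≡ suc F'
classes-nonempty {F = zero} cl a p with lab cl (a , p)
... | ()
classes-nonempty {F = suc F} cl a p = F , refl

-- Decidability of reachability in a finite boolean relation, by
-- computing the sets of points reachable in at most k steps until they
-- stabilise (which happens after at most n rounds).

anyᵇ : ∀ {n} → (Fin n → Bool) → Bool
anyᵇ {zero} f = false
anyᵇ {suc n} f = f zero ∨ anyᵇ (f ∘ suc)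

anyᵇ-sound : ∀ {n} (f : Fin n → Bool) → T (anyᵇ f) → ∃[ i ] T (f i)
anyᵇ-sound {suc n} f p with ∨-elim (f zero) p
... | inj₁ q = zero , q
... | inj₂ q = let (i , r) = anyᵇ-sound (f ∘ suc) q in suc i , r

anyᵇ-complete : ∀ {n} (f : Fin n → Bool) i → T (f i) → T (anyᵇ f)
anyᵇ-complete {suc n} f zero p = ∨-intro₁ (f zero) p
anyᵇ-complete {suc n} f (suc i) p = ∨-intro₂ (f zero) (anyᵇ-complete (f ∘ suc) i p)

module Reachability {n : ℕ} (R : Fin n → Fin n → Bool) (u : Fin n) where

  Rel : Fin n → Fin n → Set
  Rel a b = T (R a b)

  within : ℕ → Fin n → Bool
  within zero v = does (u ≟F v)
  within (suc k) v = within k v ∨ anyᵇ (λ w → within k w ∧ R w v)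

  within-sound : ∀ k v → T (within k v) → Star Rel u v
  within-sound zero v p with u ≟F v
  ... | yes refl = ε
  within-sound (suc k) v p with ∨-elim (within k v) p
  ... | inj₁ q = within-sound k v q
  ... | inj₂ q = let (w , r) = anyᵇ-sound _ q ; (a , b) = ∧-elim (within k w) r in within-sound k w a ◅◅ (b ◅ ε)

  within-step : ∀ k v → T (within k v) → T (within (suc k) v)
  within-step k v p = ∨-intro₁ (within k v) p

  within-start : ∀ k → T (within k u)
  within-start zero = ≟-refl u
  within-start (suc k) = within-step k u (within-start k)

  Stable : ℕ → Set
  Stable k = ∀ v → T (within (suc k) v) → T (within k v)

  step : ∀ k → Stable k ⊎ suc (countTrue (within k)) ≤ countTrue (within (suc k))
  step k with countTrue (within (suc k)) ≤? countTrue (within k)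
  ... | yes le = inj₁ (count-≤-reflects (within k) (within (suc k)) (within-step k) le)
  ... | no gt = inj₂ (≰⇒> gt)

  grow : ∀ k → (∃[ j ] Stable j) ⊎ suc k ≤ countTrue (within k)
  grow zero = inj₂ (count-pos (within 0) u (within-start 0))
  grow (suc k) with grow k
  ... | inj₁ st = inj₁ st
  ... | inj₂ le with step k
  ... | inj₁ st = inj₁ (k , st)
  ... | inj₂ lt = inj₂ (≤-trans (s≤s le) lt)

  -- Since at most n points can be reached, some round is stable.
  stable : ∃[ j ] Stable j
  stable with grow n
  ... | inj₁ st = st
  ... | inj₂ le = ⊥-elim (<⇒≱ le (count-≤n (within n)))

  -- A stable round is closed under R, hence contains everything reachable.
  within-complete : ∀ j → Stable j → ∀ v → Star Rel u v → T (within j v)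
  within-complete j st v s = go u v (within-start j) s
    where
    closed : ∀ w v → T (within j w) → Rel w v → T (within j v)
    closed w v p r = st v (∨-intro₂ (within j v) (anyᵇ-complete _ w (∧-intro p r)))
    go : ∀ w v → T (within j w) → Star Rel w v → T (within j v)
    go w .w p ε = p
    go w v p (r ◅ s) = go _ v (closed w _ p r) s

  reachable? : ∀ v → Dec (Star Rel u v)
  reachable? v with stable
  ... | j , st with within j v in eq
  ... | true = yes (within-sound j v (subst T (sym≡ eq) tt))
  ... | false = no λ s → subst T eq (within-complete j st v s)

adj-irr : ∀ {n} (G : Graph n) u → ¬ Adj G u u
adj-irr G u p = subst T (irrefl G u) p

adj-sym : ∀ {n} (G : Graph n) u v → Adj G u v → Adj G v u
adj-sym G u v p = subst T (Graph.sym G u v) p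

adj-≢ : ∀ {n} (G : Graph n) u v → Adj G u v → u ≢ v
adj-≢ G u v p refl = adj-irr G u p

upRow : ∀ {n} → Graph n → Fin n → ℕ
upRow G i = countTrue (λ j → adj G i j ∧ (toℕ i <ᵇ toℕ j))

edge⇒numEdges-pos : ∀ {n} (G : Graph n) u v → Adj G u v → 1 ≤ numEdges G
edge⇒numEdges-pos G u v p with <-cmp (toℕ u) (toℕ v)
... | tri< lt _ _ = ≤-trans (count-pos _ v (∧-intro p (<⇒<ᵇ lt))) (sumFin-term≤ (upRow G) u)
... | tri≈ _ e _ = ⊥-elim (adj-≢ G u v p (toℕ-injective e))
... | tri> _ _ gt = ≤-trans (count-pos _ u (∧-intro (adj-sym G u v p) (<⇒<ᵇ gt))) (sumFin-term≤ (upRow G) v)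

-- Removing one edge ab (with a < b) from G and keeping all other pairs
-- decreases the number of edges by one: only row a changes, and it loses b.
numEdges-delete : ∀ {n} (G H : Graph n) (a b : Fin n) → toℕ a < toℕ b → Adj G a b → adj H a b ≡ false →
  (∀ i j → ¬ (i ≡ a × j ≡ b) → ¬ (i ≡ b × j ≡ a) → adj H i j ≡ adj G i j) →
  numEdges H + 1 ≡ numEdges G
numEdges-delete {n} G H a b a<b ab hab same = +-cancelʳ-≡ (upRow H a) _ _
  (begin
    numEdges H + 1 + upRow H a    ≡⟨ +-assoc (numEdges H) 1 _ ⟩
    numEdges H + (1 + upRow H a)  ≡⟨ cong (numEdges H +_) (trans (+-comm 1 _) row-a) ⟩
    numEdges H + upRow G a        ≡⟨ sumFin-update (upRow H) (upRow G) a rows ⟩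
    numEdges G + upRow H a        ∎)
  where
  open ≡-Reasoning
  b≮a : (toℕ b <ᵇ toℕ a) ≡ false
  b≮a with toℕ b <ᵇ toℕ a in eq
  ... | true = ⊥-elim (<⇒≱ (<ᵇ⇒< (toℕ b) (toℕ a) (subst T (sym≡ eq) tt)) (<⇒≤ a<b))
  ... | false = refl
  entry : ∀ i j → i ≢ a ⊎ j ≢ b → (adj H i j ∧ (toℕ i <ᵇ toℕ j)) ≡ (adj G i j ∧ (toℕ i <ᵇ toℕ j))
  entry i j ne with i ≟F b | j ≟F a
  ... | yes refl | yes refl rewrite b≮a = trans (∧-zeroʳ _) (sym≡ (∧-zeroʳ _))
  ... | yes refl | no q = cong (_∧ _) (same i j (λ { (e₁ , e₂) → not-ab ne e₁ e₂ }) (λ { (_ , e) → q e }))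
    where
    not-ab : i ≢ a ⊎ j ≢ b → i ≡ a → j ≡ b → ⊥
    not-ab (inj₁ z) e₁ e₂ = z e₁
    not-ab (inj₂ z) e₁ e₂ = z e₂
  ... | no p | _ = cong (_∧ _) (same i j (λ { (e₁ , e₂) → not-ab ne e₁ e₂ }) (λ { (e , _) → p e }))
    where
    not-ab : i ≢ a ⊎ j ≢ b → i ≡ a → j ≡ b → ⊥
    not-ab (inj₁ z) e₁ e₂ = z e₁
    not-ab (inj₂ z) e₁ e₂ = z e₂
  rows : ∀ i → i ≢ a → upRow H i ≡ upRow G i
  rows i ne = count-ext _ _ (λ j → entry i j (inj₁ ne))
  ab-counted : (adj G a b ∧ (toℕ a <ᵇ toℕ b)) ≡ true
  ab-counted = T⇒≡true (∧-intro ab (<⇒<ᵇ a<b))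
  row-a : upRow H a + 1 ≡ upRow G a
  row-a with count-update (λ j → adj H a j ∧ (toℕ a <ᵇ toℕ j)) (λ j → adj G a j ∧ (toℕ a <ᵇ toℕ j)) b
               (λ j ne → entry a j (inj₂ ne))
  ... | e rewrite ab-counted | hab = trans e (+-identityʳ _)

module EdgeDeletion {n : ℕ} (G : Graph n) (x y : Fin n) (xy : Adj G x y) where

  x≢y : x ≢ y
  x≢y = adj-≢ G x y xy

  yx : Adj G y x
  yx = adj-sym G x y xy

  IsE : Fin n → Fin n → Set
  IsE u v = (u ≡ x × v ≡ y) ⊎ (u ≡ y × v ≡ x)

  IsE? : ∀ u v → Dec (IsE u v)
  IsE? u v = (u ≟F x ×-dec v ≟F y) ⊎-dec (u ≟F y ×-dec v ≟F x)

  isE : Fin n → Fin n → Bool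
  isE u v = does (IsE? u v)

  IsE-swap : ∀ {u v} → IsE u v → IsE v u
  IsE-swap (inj₁ (a , b)) = inj₂ (b , a)
  IsE-swap (inj₂ (a , b)) = inj₁ (b , a)

  isE-sym : ∀ u v → isE u v ≡ isE v u
  isE-sym u v = does-cong IsE-swap IsE-swap (IsE? u v) (IsE? v u)

  isE-true : ∀ u v → IsE u v → isE u v ≡ true
  isE-true u v = dec-true (IsE? u v)

  isE-false : ∀ u v → ¬ IsE u v → isE u v ≡ false
  isE-false u v = dec-false (IsE? u v)

  IsE-adj : ∀ u v → IsE u v → Adj G u v
  IsE-adj u v (inj₁ (refl , refl)) = xy
  IsE-adj u v (inj₂ (refl , refl)) = yx

  IsE-other : ∀ u v w → IsE u v → IsE u w → w ≡ v
  IsE-other u v w (inj₁ (_ , v≡y)) (inj₁ (_ , w≡y)) = trans w≡y (sym≡ v≡y)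
  IsE-other u v w (inj₂ (_ , v≡x)) (inj₂ (_ , w≡x)) = trans w≡x (sym≡ v≡x)
  IsE-other u v w (inj₁ (u≡x , _)) (inj₂ (u≡y , _)) = ⊥-elim (x≢y (trans (sym≡ u≡x) u≡y))
  IsE-other u v w (inj₂ (u≡y , _)) (inj₁ (u≡x , _)) = ⊥-elim (x≢y (trans (sym≡ u≡x) u≡y))

  H : Graph n
  H = record
    { adj = λ u v → adj G u v ∧ not (isE u v)
    ; sym = λ u v → cong₂ (λ a b → a ∧ not b) (Graph.sym G u v) (isE-sym u v)
    ; irrefl = λ v → cong (_∧ _) (irrefl G v) }

  H→G : ∀ u v → Adj H u v → Adj G u v
  H→G u v p = proj₁ (∧-elim (adj G u v) p)

  H→¬E : ∀ u v → Adj H u v → ¬ IsE u v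
  H→¬E u v p e with isE u v | isE-true u v e | proj₂ (∧-elim (adj G u v) p)
  ... | true | _ | ()

  G→H : ∀ u v → Adj G u v → ¬ IsE u v → Adj H u v
  G→H u v p ne = ∧-intro p (subst (λ b → T (not b)) (sym≡ (isE-false u v ne)) tt)

  G∖H⇒E : ∀ u v → Adj G u v → ¬ Adj H u v → IsE u v
  G∖H⇒E u v p ¬q with IsE? u v
  ... | yes e = e
  ... | no ne = ⊥-elim (¬q (G→H u v p ne))

  adjH-E : ∀ u v → IsE u v → adj H u v ≡ false
  adjH-E u v e rewrite isE-true u v e = ∧-zeroʳ _

  adjH-¬E : ∀ u v → ¬ IsE u v → adj H u v ≡ adj G u v
  adjH-¬E u v ne rewrite isE-false u v ne = ∧-identityʳ _

  degH-≤ : ∀ v → deg H v ≤ deg G v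
  degH-≤ v = count-mono _ _ (λ w p → H→G v w p)

  degH-other : ∀ v → v ≢ x → v ≢ y → deg H v ≡ deg G v
  degH-other v nx ny = count-ext _ _ (λ w → adjH-¬E v w (λ { (inj₁ (e , _)) → nx e ; (inj₂ (e , _)) → ny e }))

  degH-endpoint : ∀ u v → IsE u v → deg H u + 1 ≡ deg G u
  degH-endpoint u v e
    with count-update (adj H u) (adj G u) v (λ w w≢v → adjH-¬E u w (λ e' → w≢v (IsE-other u v w e e')))
  ... | eq rewrite adjH-E u v e | T⇒≡true (IsE-adj u v e) = trans eq (+-identityʳ _)

  numEdgesH : numEdges H + 1 ≡ numEdges G
  numEdgesH with <-cmp (toℕ x) (toℕ y)
  ... | tri< lt _ _ = numEdges-delete G H x y lt xy (adjH-E x y (inj₁ (refl , refl)))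
                        (λ i j n₁ n₂ → adjH-¬E i j (λ { (inj₁ e) → n₁ e ; (inj₂ e) → n₂ e }))
  ... | tri≈ _ e _ = ⊥-elim (x≢y (toℕ-injective e))
  ... | tri> _ _ gt = numEdges-delete G H y x gt yx (adjH-E y x (inj₂ (refl , refl)))
                        (λ i j n₁ n₂ → adjH-¬E i j (λ { (inj₁ e) → n₂ e ; (inj₂ e) → n₁ e }))

-- Let s be obtained from r by skipping, on a set Keep,
-- at most one point at a time: for a ∈ Keep either r a ∈ Keep and s a = r a,
-- or r a ∉ Keep, r (r a) ∈ Keep and s a = r (r a).  This describes both the
-- rotation at an endpoint of a deleted edge and the face permutation of the
-- graph after deletion.
module FirstReturn {A : Set} (r s : A → A) (Keep : A → Set)
  (step : ∀ a → Keep a → (Keep (r a) × s a ≡ r a) ⊎ (¬ Keep (r a) × Keep (r (r a)) × s a ≡ r (r a))) where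

  s-keeps : ∀ a → Keep a → Keep (s a)
  s-keeps a ka with step a ka
  ... | inj₁ (kra , e) = subst Keep (sym≡ e) kra
  ... | inj₂ (_ , krra , e) = subst Keep (sym≡ e) krra

  s-orbit⊆r-orbit : ∀ a m → Keep a → ∃[ k ] iter r a k ≡ iter s a m
  s-orbit⊆r-orbit a zero ka = 0 , refl
  s-orbit⊆r-orbit a (suc m) ka with step (iter s a m) (iter-preserves Keep s s-keeps a m ka)
  ... | inj₁ (_ , e) = orbit-trans r a _ _ (s-orbit⊆r-orbit a m ka) (1 , sym≡ e)
  ... | inj₂ (_ , _ , e) = orbit-trans r a _ _ (s-orbit⊆r-orbit a m ka) (2 , sym≡ e)

  r-orbit⊆s-orbit : ∀ a b k → Keep a → Keep b → iter r a k ≡ b → ∃[ m ] iter s a m ≡ b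
  r-orbit⊆s-orbit a b k ka kb e = go k a k ≤-refl ka e
    where
    -- induction on a bound t for k, since a skip consumes two r-steps
    go : ∀ t a k → k ≤ t → Keep a → iter r a k ≡ b → ∃[ m ] iter s a m ≡ b
    go t a zero _ ka e = 0 , e
    go (suc t) a (suc k) (s≤s k≤t) ka e with step a ka
    ... | inj₁ (kra , es) =
      let (m , em) = go t (r a) k k≤t kra (trans (sym≡ (iter-suc-inner r a k)) e)
      in suc m , trans (iter-suc-inner s a m) (trans (cong (λ w → iter s w m) es) em)
    ... | inj₂ (¬kra , krra , es) with k
    ...   | zero = ⊥-elim (¬kra (subst Keep (sym≡ e) kb))
    ...   | suc k' =
      let (m , em) = go t (r (r a)) k' (≤-trans (n≤1+n k') k≤t) krra
                       (trans (sym≡ (trans (iter-suc-inner r a (suc k')) (iter-suc-inner r (r a) k'))) e)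
      in suc m , trans (iter-suc-inner s a m) (trans (cong (λ w → iter s w m) es) em)

  s-injective : (D : A → Set) → (∀ a → Keep a → D a) → (∀ a → D a → D (r a)) →
                (∀ a b → D a → D b → r a ≡ r b → a ≡ b) →
                ∀ a b → Keep a → Keep b → s a ≡ s b → a ≡ b
  s-injective D Keep⊆D r-D r-inj a b ka kb e with Keep⊆D a ka | Keep⊆D b kb | step a ka | step b kb
  ... | da | db | inj₁ (_ , ea) | inj₁ (_ , eb) = r-inj a b da db (trans (sym≡ ea) (trans e eb))
  ... | da | db | inj₂ (_ , _ , ea) | inj₂ (_ , _ , eb) =
    r-inj a b da db (r-inj (r a) (r b) (r-D a da) (r-D b db) (trans (sym≡ ea) (trans e eb)))
  ... | da | db | inj₁ (_ , ea) | inj₂ (¬krb , _ , eb) =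
    ⊥-elim (¬krb (subst Keep (r-inj a (r b) da (r-D b db) (trans (sym≡ ea) (trans e eb))) ka))
  ... | da | db | inj₂ (¬kra , _ , ea) | inj₁ (_ , eb) =
    ⊥-elim (¬kra (subst Keep (r-inj b (r a) db (r-D a da) (trans (sym≡ eb) (trans (sym≡ e) ea))) kb))

module DeletedRotation {n : ℕ} (G : Graph n) (x y : Fin n) (xy : Adj G x y) (R : Rotation G) where
  open EdgeDeletion G x y xy

  rotH : Fin n → Fin n → Fin n
  rotH v u = if isE v (rot R v u) then rot R v (rot R v u) else rot R v u

  rotH-skip : ∀ v u → IsE v (rot R v u) → rotH v u ≡ rot R v (rot R v u)
  rotH-skip v u e rewrite isE-true v (rot R v u) e = refl

  rotH-keep : ∀ v u → ¬ IsE v (rot R v u) → rotH v u ≡ rot R v u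
  rotH-keep v u ne rewrite isE-false v (rot R v u) ne = refl

  -- rotH v is the first-return map of rot R v on the H-neighbours of v:
  -- two consecutive skips would force rot R v u ≡ u.
  rotH-step : ∀ v u → Adj H v u →
              (Adj H v (rot R v u) × rotH v u ≡ rot R v u) ⊎
              (¬ Adj H v (rot R v u) × Adj H v (rot R v (rot R v u)) × rotH v u ≡ rot R v (rot R v u))
  rotH-step v u p with IsE? v (rot R v u)
  ... | no ne = inj₁ (G→H v w Gvw ne , rotH-keep v u ne)
    where
    w : Fin n
    w = rot R v u
    Gvw : Adj G v w
    Gvw = rot-adj R v u (H→G v u p)
  ... | yes e = inj₂ ((λ q → H→¬E v (rot R v u) q e) , G→H v w' Gvw' ¬Ew' , rotH-skip v u e)
    where
    w w' : Fin n
    w = rot R v u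
    w' = rot R v w
    Gvw' : Adj G v w'
    Gvw' = rot-adj R v w (rot-adj R v u (H→G v u p))
    ¬Ew' : ¬ IsE v w'
    ¬Ew' e' = H→¬E v u p (subst (IsE v) w≡u e)
      where
      w≡u : w ≡ u
      w≡u = rot-inj R v w u (rot-adj R v u (H→G v u p)) (H→G v u p) (IsE-other v w w' e e')

  module AtVertex (v : Fin n) = FirstReturn (rot R v) (rotH v) (Adj H v) (rotH-step v)

  RH : Rotation H
  RH = record
    { rot = rotH
    ; rot-adj = λ v → AtVertex.s-keeps v
    ; rot-inj = λ v → AtVertex.s-injective v (Adj G v) (H→G v) (rot-adj R v) (rot-inj R v)
    ; rot-cyc = λ v u u' p q → let (k , e) = rot-cyc R v u u' (H→G v u p) (H→G v u' q)
                               in AtVertex.r-orbit⊆s-orbit v u u' k p q e }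

Pair : ℕ → Set
Pair n = Fin n × Fin n

_≟P_ : ∀ {n} (a b : Pair n) → Dec (a ≡ b)
_≟P_ = Product.≡-dec _≟F_ _≟F_

IsDart : ∀ {n} (Γ : Graph n) → Pair n → Set
IsDart Γ d = Adj Γ (proj₁ d) (proj₂ d)

-- Pairs are encoded injectively in Fin (n * n), so orbits on pairs are finite.
encode : ∀ {n} → Pair n → Fin (n * n)
encode (u , v) = combine u v

decode : ∀ {n} → Fin (n * n) → Pair n
decode {n} = remQuot n

decode-encode : ∀ {n} (a : Pair n) → decode (encode a) ≡ a
decode-encode (u , v) = remQuot-combine u v

encode-inj : ∀ {n} {a b : Pair n} → encode a ≡ encode b → a ≡ b
encode-inj {a = a} {b} e = trans (sym≡ (decode-encode a)) (trans (cong decode e) (decode-encode b))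

faceStep-dart : ∀ {n} (Γ : Graph n) (Q : Rotation Γ) d → IsDart Γ d → IsDart Γ (faceStep Q d)
faceStep-dart Γ Q (u , v) p = rot-adj Q v u (adj-sym Γ u v p)

faceStep-inj : ∀ {n} (Γ : Graph n) (Q : Rotation Γ) a b → IsDart Γ a → IsDart Γ b →
               faceStep Q a ≡ faceStep Q b → a ≡ b
faceStep-inj Γ Q (u , v) (u' , v') p q e with ,-injective e
... | refl , e₂ = cong (_, v) (rot-inj Q v u u' (adj-sym Γ u v p) (adj-sym Γ u' v q) e₂)

module PairOrbits {n : ℕ} (D : Pair n → Set) (f : Pair n → Pair n)
                  (D-closed : ∀ a → D a → D (f a)) (f-inj : ∀ a b → D a → D b → f a ≡ f b → a ≡ b) where

  Orbit : Pair n → Pair n → Set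
  Orbit a b = ∃[ k ] iter f a k ≡ b

  private
    module Finite = FiniteOrbits encode encode-inj f
    module Cyclic = Finite.Injective D D-closed f-inj

  orbit-refl : ∀ a → D a → Orbit a a
  orbit-refl a _ = 0 , refl

  orbit-sym : ∀ a b → D a → D b → Orbit a b → Orbit b a
  orbit-sym a b p _ (k , e) = Cyclic.orbit-sym a b k p e

  orbit-trans′ : ∀ a b c → D a → D b → D c → Orbit a b → Orbit b c → Orbit a c
  orbit-trans′ a b c _ _ _ = orbit-trans f a b c

  orbit? : ∀ a b → Dec (Orbit a b)
  orbit? = Finite.orbit? _≟P_

  fixed-orbit : ∀ a e → D a → f e ≡ e → Orbit a e → a ≡ e
  fixed-orbit a e p fe r = let (k , ek) = Cyclic.orbit-sym a e (proj₁ r) p (proj₂ r)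
                           in trans (sym≡ ek) (iter-fixed f e fe k)

  orbit-classes : (∀ a → Dec (D a)) → Σ ℕ (Classes D Orbit)
  orbit-classes D? = classes-exist (n * n) encode decode decode-encode D Orbit D? orbit?
                       orbit-refl orbit-sym orbit-trans′

-- Deleting xy changes the face permutation σ of G into the
-- face permutation σH of H.  The link is φ = σ ∘ τ, where τ reverses the two
-- darts of xy: φ agrees with σ off the deleted darts dxy, dyx, and σH is
-- the first-return map of φ on the darts of H.  So faces of H are φ-orbits
-- with dxy, dyx removed, and φ-orbits arise from σ-orbits by cutting or
-- joining at dxy, dyx.
module FaceSurgery {n : ℕ} (G : Graph n) (x y : Fin n) (xy : Adj G x y) (R : Rotation G) where
  open EdgeDeletion G x y xy
  open DeletedRotation G x y xy R

  dxy dyx : Pair n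
  dxy = (x , y)
  dyx = (y , x)

  dxy≢dyx : dxy ≢ dyx
  dxy≢dyx e = x≢y (,-injectiveˡ e)

  DG DH : Pair n → Set
  DG = IsDart G
  DH = IsDart H

  InE : Pair n → Set
  InE d = IsE (proj₁ d) (proj₂ d)

  InE? : ∀ d → Dec (InE d)
  InE? d = IsE? (proj₁ d) (proj₂ d)

  InE-cases : ∀ d → InE d → d ≡ dxy ⊎ d ≡ dyx
  InE-cases (u , v) (inj₁ (refl , refl)) = inj₁ refl
  InE-cases (u , v) (inj₂ (refl , refl)) = inj₂ refl

  InE-dxy : InE dxy
  InE-dxy = inj₁ (refl , refl)

  InE-dyx : InE dyx
  InE-dyx = inj₂ (refl , refl)

  σ σH : Pair n → Pair n
  σ = faceStep R
  σH = faceStep RH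

  τ : Pair n → Pair n
  τ d = if isE (proj₁ d) (proj₂ d) then (proj₂ d , proj₁ d) else d

  τ-E : ∀ d → InE d → τ d ≡ (proj₂ d , proj₁ d)
  τ-E (u , v) e rewrite isE-true u v e = refl

  τ-¬E : ∀ d → ¬ InE d → τ d ≡ d
  τ-¬E (u , v) ne rewrite isE-false u v ne = refl

  τ-involutive : ∀ d → τ (τ d) ≡ d
  τ-involutive (u , v) with InE? (u , v)
  ... | yes e = trans (cong τ (τ-E (u , v) e)) (τ-E (v , u) (IsE-swap e))
  ... | no ne = trans (cong τ (τ-¬E (u , v) ne)) (τ-¬E (u , v) ne)

  τ-dart : ∀ d → DG d → DG (τ d)
  τ-dart (u , v) p with InE? (u , v)
  ... | yes e = subst DG (sym≡ (τ-E (u , v) e)) (adj-sym G u v p)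
  ... | no ne = subst DG (sym≡ (τ-¬E (u , v) ne)) p

  φ : Pair n → Pair n
  φ d = σ (τ d)

  φ-dart : ∀ d → DG d → DG (φ d)
  φ-dart d p = faceStep-dart G R (τ d) (τ-dart d p)

  φ-inj : ∀ a b → DG a → DG b → φ a ≡ φ b → a ≡ b
  φ-inj a b p q e = trans (sym≡ (τ-involutive a))
    (trans (cong τ (faceStep-inj G R (τ a) (τ b) (τ-dart a p) (τ-dart b q) e)) (τ-involutive b))

  φ-¬E : ∀ d → ¬ InE d → φ d ≡ σ d
  φ-¬E d ne = cong σ (τ-¬E d ne)

  φ-endpoint : ∀ u v → IsE u v → φ (u , v) ≡ (u , rot R u v)
  φ-endpoint u v e = cong σ (τ-E (u , v) e)

  φ-dxy : φ dxy ≡ σ dyx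
  φ-dxy = cong σ (τ-E dxy InE-dxy)

  φ-dyx : φ dyx ≡ σ dxy
  φ-dyx = cong σ (τ-E dyx InE-dyx)

  -- loop e is 1 if φ fixes e, i.e. the dart e forms a φ-orbit on its own.
  loop : Pair n → ℕ
  loop e = indicator (does (φ e ≟P e))

  σH-step : ∀ d → DH d → (DH (φ d) × σH d ≡ φ d) ⊎ (¬ DH (φ d) × DH (φ (φ d)) × σH d ≡ φ (φ d))
  σH-step (u , v) p with rotH-step v u (adj-sym H u v p)
  ... | inj₁ (q , e) = inj₁ (subst DH (sym≡ φd) q , trans (cong (v ,_) e) (sym≡ φd))
    where
    φd : φ (u , v) ≡ (v , rot R v u)
    φd = φ-¬E (u , v) (H→¬E u v p)
  ... | inj₂ (¬q , q' , e) = inj₂ ((λ h → ¬q (subst DH φd h)) , subst DH (sym≡ φφd) q' , trans (cong (v ,_) e) (sym≡ φφd))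
    where
    w : Fin n
    w = rot R v u
    φd : φ (u , v) ≡ (v , w)
    φd = φ-¬E (u , v) (H→¬E u v p)
    φφd : φ (φ (u , v)) ≡ (v , rot R v w)
    φφd = trans (cong φ φd) (cong σ (τ-E (v , w) (G∖H⇒E v w (rot-adj R v u (adj-sym G u v (H→G u v p))) ¬q)))

  module Return = FirstReturn φ σH DH σH-step

  module σOrbits = PairOrbits DG σ (faceStep-dart G R) (faceStep-inj G R)
  module φOrbits = PairOrbits DG φ φ-dart φ-inj

  OG Oφ OH : Pair n → Pair n → Set
  OG = SameFace R
  Oφ = φOrbits.Orbit
  OH = SameFace RH

  OH→Oφ : ∀ d d' → DH d → OH d d' → Oφ d d'
  OH→Oφ d d' p (k , e) = let (j , e') = Return.s-orbit⊆r-orbit d k p in j , trans e' e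

  Oφ→OH : ∀ d d' → DH d → DH d' → Oφ d d' → OH d d'
  Oφ→OH d d' p p' (k , e) = Return.r-orbit⊆s-orbit d d' k p p' e

  -- σ-orbits and φ-orbits agree once the classes of dxy and dyx are merged.
  module MG = MergeClosure DG OG σOrbits.orbit-refl σOrbits.orbit-sym σOrbits.orbit-trans′ dxy dyx xy yx
  module Mφ = MergeClosure DG Oφ φOrbits.orbit-refl φOrbits.orbit-sym φOrbits.orbit-trans′ dxy dyx xy yx

  σ-step : ∀ c → DG c → Mφ.M c (σ c)
  σ-step c p with InE? c
  ... | no ne = inj₁ (1 , φ-¬E c ne)
  ... | yes e with InE-cases c e
  ...   | inj₁ refl = inj₂ (inj₁ (φOrbits.orbit-refl dxy p , φOrbits.orbit-sym _ _ yx (faceStep-dart G R dxy p) (1 , φ-dyx)))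
  ...   | inj₂ refl = inj₂ (inj₂ (φOrbits.orbit-refl dyx p , φOrbits.orbit-sym _ _ xy (faceStep-dart G R dyx p) (1 , φ-dxy)))

  φ-step : ∀ c → DG c → MG.M c (φ c)
  φ-step c p with InE? c
  ... | no ne = inj₁ (1 , sym≡ (φ-¬E c ne))
  ... | yes e with InE-cases c e
  ...   | inj₁ refl = inj₂ (inj₁ (σOrbits.orbit-refl dxy p , σOrbits.orbit-sym _ _ yx (φ-dart dxy p) (1 , sym≡ φ-dxy)))
  ...   | inj₂ refl = inj₂ (inj₂ (σOrbits.orbit-refl dyx p , σOrbits.orbit-sym _ _ xy (φ-dart dyx p) (1 , sym≡ φ-dyx)))

  OG⊆Mφ : ∀ d d' → DG d → DG d' → OG d d' → Mφ.M d d'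
  OG⊆Mφ d d' p _ (k , e) = subst (Mφ.M d) e (Mφ.merge-orbit σ (faceStep-dart G R) σ-step d k p)

  Oφ⊆MG : ∀ d d' → DG d → DG d' → Oφ d d' → MG.M d d'
  Oφ⊆MG d d' p _ (k , e) = subst (MG.M d) e (MG.merge-orbit φ φ-dart φ-step d k p)

  agree : ∀ c m → (∀ j → j < m → ¬ InE (iter σ c j)) → ∀ j → j ≤ m → iter φ c j ≡ iter σ c j
  agree c m h zero _ = refl
  agree c m h (suc j) le = trans (cong φ (agree c m h j (≤-trans (n≤1+n j) le))) (φ-¬E _ (h j le))

  walk : ∀ c k → DG c → (∀ j → j < k → ¬ InE (iter σ c j)) → Star (Adj H) (proj₁ c) (proj₁ (iter σ c k))
  walk c zero p h = ε
  walk c (suc k) p h = walk c k p (λ j lt → h j (≤-trans lt (n≤1+n k))) ◅◅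
    (G→H _ _ (iter-preserves DG σ (faceStep-dart G R) c k p) (h k ≤-refl) ◅ ε)

  t : Pair n
  t = σ dyx

  t-dart : DG t
  t-dart = faceStep-dart G R dyx yx

  t-to-dyx : OG t dyx
  t-to-dyx = σOrbits.orbit-sym dyx t yx t-dart (1 , refl)

  two-faces : ¬ OG dxy dyx → Oφ dxy dyx × Star (Adj H) x y
  two-faces ¬OG with least (λ k → iter σ t k ≡ dyx) (λ k → iter σ t k ≟P dyx) (proj₁ t-to-dyx) (proj₂ t-to-dyx)
  ... | m , hit , before =
    (suc m , trans (iter-suc-inner φ dxy m) (trans (cong (λ w → iter φ w m) φ-dxy) (trans (agree t m avoids m ≤-refl) hit))) ,
    subst (Star (Adj H) x) (cong proj₁ hit) (walk t m t-dart avoids)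
    where
    avoids : ∀ j → j < m → ¬ InE (iter σ t j)
    avoids j lt e with InE-cases (iter σ t j) e
    ... | inj₂ e' = before j lt e'
    ... | inj₁ e' = ¬OG (σOrbits.orbit-sym dyx dxy yx xy (suc j , trans (iter-suc-inner σ dyx j) e'))

  -- If dxy and dyx lie on the same face of G, then φ separates them: the
  -- first deleted dart met after dyx closes up either the σ-orbit of dyx
  -- or the φ-orbit of dxy before the other dart is reached.
  one-face : OG dxy dyx → ¬ Oφ dxy dyx
  one-face OG-dxy-dyx with least (λ k → InE (iter σ t k)) (λ k → InE? (iter σ t k)) (proj₁ t-to-dxy)
                               (subst InE (sym≡ (proj₂ t-to-dxy)) InE-dxy)
    where
    t-to-dxy : OG t dxy
    t-to-dxy = σOrbits.orbit-trans′ t dyx dxy t-dart yx xy t-to-dyx (σOrbits.orbit-sym dxy dyx xy yx OG-dxy-dyx)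
  ... | m , hit , avoids with InE-cases (iter σ t m) hit
  ...   | inj₂ hits-dyx = λ _ → orbit-avoid σ dyx dxy m (trans (iter-suc-inner σ dyx m) hits-dyx) misses
                                  (proj₁ dyx-to-dxy) (proj₂ dyx-to-dxy)
    where
    dyx-to-dxy : OG dyx dxy
    dyx-to-dxy = σOrbits.orbit-sym dxy dyx xy yx OG-dxy-dyx
    misses : ∀ j → j ≤ m → iter σ dyx j ≢ dxy
    misses zero _ e = dxy≢dyx (sym≡ e)
    misses (suc j) le e = avoids j le (subst InE (sym≡ (trans (sym≡ (iter-suc-inner σ dyx j)) e)) InE-dxy)
  ...   | inj₁ hits-dxy = λ { (k , e) → orbit-avoid φ dxy dyx m period misses k e }
    where
    shift : ∀ j → iter φ dxy (suc j) ≡ iter φ t j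
    shift j = trans (iter-suc-inner φ dxy j) (cong (λ w → iter φ w j) φ-dxy)
    period : iter φ dxy (suc m) ≡ dxy
    period = trans (shift m) (trans (agree t m avoids m ≤-refl) hits-dxy)
    misses : ∀ j → j ≤ m → iter φ dxy j ≢ dyx
    misses zero _ e = dxy≢dyx e
    misses (suc j) le e =
      avoids j le (subst InE (sym≡ (trans (sym≡ (trans (shift j) (agree t m avoids j (≤-trans (n≤1+n j) le)))) e)) InE-dyx)

module FaceCount {n : ℕ} (G : Graph n) (x y : Fin n) (xy : Adj G x y) (R : Rotation G)
                 (F : ℕ) (faces : Classes (IsDart G) (SameFace R) F) where
  open EdgeDeletion G x y xy
  open FaceSurgery G x y xy R

  remove-dart : ∀ {D : Pair n → Set} {F'} → (∀ a → D a → DG a) → Classes D Oφ F' →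
                ∀ e → D e → (φ e ≢ e → D (φ e)) →
                Σ ℕ λ F'' → Classes (λ a → D a × a ≢ e) Oφ F'' × F'' + indicator (does (φ e ≟P e)) ≡ F'
  remove-dart D⊆DG cl e De D-φe with φ e ≟P e
  ... | yes fixed with classes-nonempty cl e De
  ...   | F'' , refl =
    F'' , classes-remove-singleton cl e De (λ a p r → φOrbits.fixed-orbit a e (D⊆DG a p) fixed r) , +-comm F'' 1
  remove-dart D⊆DG cl e De D-φe | no moved =
    _ , classes-remove-nonsingleton _≟P_ cl e De (φ e) (D-φe moved) moved
          (φOrbits.orbit-sym e (φ e) (D⊆DG e De) (φ-dart e (D⊆DG e De)) (1 , refl)) ,
        +-identityʳ _

  faces-from-φ : ∀ Fφ → Classes DG Oφ Fφ → Σ ℕ λ FH → Classes DH OH FH × FH + loop dxy + loop dyx ≡ Fφ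
  faces-from-φ Fφ cl with remove-dart (λ a p → p) cl dxy xy (λ _ → φ-dart dxy xy)
  ... | F₁ , cl₁ , e₁ with remove-dart (λ a → proj₁) cl₁ dyx (yx , dxy≢dyx ∘ sym≡) (λ _ → φ-dart dyx yx , φdyx≢dxy)
    where
    φdyx≢dxy : φ dyx ≢ dxy
    φdyx≢dxy e = x≢y (sym≡ (cong proj₁ (trans (sym≡ φ-dyx) e)))
  ... | F₂ , cl₂ , e₂ = F₂ , classes-transport cl₂ to-D₂ from-D₂ (λ a b p q r → Oφ→OH a b p q r) (λ a b p _ r → OH→Oφ a b p r) ,
    (begin
      F₂ + loop dxy + loop dyx    ≡⟨ +-assoc F₂ _ _ ⟩
      F₂ + (loop dxy + loop dyx)  ≡⟨ cong (F₂ +_) (+-comm (loop dxy) _) ⟩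
      F₂ + (loop dyx + loop dxy)  ≡⟨ +-assoc F₂ _ _ ⟨
      F₂ + loop dyx + loop dxy    ≡⟨ cong (_+ loop dxy) e₂ ⟩
      F₁ + loop dxy               ≡⟨ e₁ ⟩
      Fφ                          ∎)
    where
    open ≡-Reasoning
    to-D₂ : ∀ a → DH a → (DG a × a ≢ dxy) × a ≢ dyx
    to-D₂ a p = (H→G _ _ p , λ e → H→¬E _ _ p (subst InE (sym≡ e) InE-dxy)) ,
                λ e → H→¬E _ _ p (subst InE (sym≡ e) InE-dyx)
    from-D₂ : ∀ a → (DG a × a ≢ dxy) × a ≢ dyx → DH a
    from-D₂ a ((p , ≢dxy) , ≢dyx) = G→H _ _ p λ e → [ ≢dxy , ≢dyx ] (InE-cases a e)

  φ-classes-TwoFaces : ¬ OG dxy dyx → Σ ℕ λ Fφ → Classes DG Oφ Fφ × Fφ + 1 ≡ F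
  φ-classes-TwoFaces ¬OG with classes-nonempty faces dxy xy
  ... | F' , refl = F' ,
    classes-transport (classes-merge faces dxy dyx xy yx ¬OG) (λ a p → p) (λ a p → p)
      (λ a b p q r → Mφ.merge-collapse (proj₁ (two-faces ¬OG)) a b p q (Mφ.merge-lift OG OG⊆Mφ a b p q r))
      Oφ⊆MG ,
    +-comm F' 1

  φ-classes-OneFace : OG dxy dyx → Σ ℕ λ Fφ → Classes DG Oφ Fφ × Fφ ≡ F + 1
  φ-classes-OneFace OG-dxy-dyx with φOrbits.orbit-classes (λ d → T? _)
  ... | Fφ , cl with classes-nonempty cl dxy xy
  ... | F' , refl = suc F' , cl , trans (cong suc F'≡F) (+-comm 1 F)
    where
    F'≡F : F' ≡ F
    F'≡F = classes-unique (classes-merge cl dxy dyx xy yx (one-face OG-dxy-dyx)) faces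
             OG⊆Mφ
             (λ a b p q r → MG.merge-collapse OG-dxy-dyx a b p q (MG.merge-lift Oφ Oφ⊆MG a b p q r))

  faces-of-H : Σ ℕ λ FH → Classes DH OH FH ×
                 ((¬ OG dxy dyx × Star (Adj H) x y × FH + loop dxy + loop dyx + 1 ≡ F) ⊎
                  (OG dxy dyx × FH + loop dxy + loop dyx ≡ F + 1))
  faces-of-H with σOrbits.orbit? dxy dyx
  ... | yes OG-dxy-dyx with φ-classes-OneFace OG-dxy-dyx
  ...   | Fφ , cl , eφ with faces-from-φ Fφ cl
  ...     | FH , clH , eH = FH , clH , inj₂ (OG-dxy-dyx , trans eH eφ)
  faces-of-H | no ¬OG with φ-classes-TwoFaces ¬OG
  ...   | Fφ , cl , eφ with faces-from-φ Fφ cl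
  ...     | FH , clH , eH = FH , clH , inj₁ (¬OG , proj₂ (two-faces ¬OG) , trans (cong (_+ 1) eH) eφ)

connected-sym : ∀ {m} (Γ : Graph m) a b → Connected Γ a b → Connected Γ b a
connected-sym Γ a b s = reverse (λ {u} {v} p → adj-sym Γ u v p) s

module ComponentCount {n : ℕ} (G : Graph n) (x y : Fin n) (xy : Adj G x y)
                      (C : ℕ) (components : Classes (λ (_ : Fin n) → ⊤) (Connected G) C) where
  open EdgeDeletion G x y xy

  Everything : Fin n → Set
  Everything _ = ⊤

  module MC = MergeClosure Everything (Connected H) (λ _ _ → ε) (λ a b _ _ → connected-sym H a b)
                           (λ _ _ _ _ _ _ s s' → s ◅◅ s') x y tt tt

  H⊆G : ∀ a b → Connected H a b → Connected G a b
  H⊆G a b s = Star.map (λ {u} {v} p → H→G u v p) s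

  G⊆merge : ∀ a b → Connected G a b → MC.M a b
  G⊆merge a .a ε = MC.merge-refl a tt
  G⊆merge a b (_◅_ {j = w} p s) = MC.merge-trans a w b tt tt tt edge (G⊆merge w b s)
    where
    edge : MC.M a w
    edge with IsE? a w
    ... | yes (inj₁ (refl , refl)) = inj₂ (inj₁ (ε , ε))
    ... | yes (inj₂ (refl , refl)) = inj₂ (inj₂ (ε , ε))
    ... | no ne = inj₁ (G→H a w p ne ◅ ε)

  merge⊆G : ∀ a b → Merge (Connected H) x y a b → Connected G a b
  merge⊆G a b (inj₁ s) = H⊆G a b s
  merge⊆G a b (inj₂ (inj₁ (s₁ , s₂))) = H⊆G a x s₁ ◅◅ (xy ◅ connected-sym G b y (H⊆G b y s₂))
  merge⊆G a b (inj₂ (inj₂ (s₁ , s₂))) = H⊆G a y s₁ ◅◅ (yx ◅ connected-sym G b x (H⊆G b x s₂))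

  components-of-H : Σ ℕ λ CH → Classes Everything (Connected H) CH ×
                      ((Connected H x y × CH ≡ C) ⊎ (¬ Connected H x y × CH ≡ C + 1))
  components-of-H with classes-exist n (λ i → i) (λ i → i) (λ _ → refl) Everything (Connected H) (λ _ → yes tt)
                         (Reachability.reachable? (adj H)) (λ _ _ → ε) (λ a b _ _ → connected-sym H a b)
                         (λ _ _ _ _ _ _ s s' → s ◅◅ s')
  ... | CH , cl with Reachability.reachable? (adj H) x y
  ... | yes x~y = CH , cl , inj₁ (x~y , classes-unique cl components
                                           (λ a b _ _ s → MC.merge-collapse x~y a b tt tt (G⊆merge a b s))
                                           (λ a b _ _ s → H⊆G a b s))
  ... | no x≁y with classes-nonempty cl x tt
  ... | CH' , refl = suc CH' , cl , inj₂ (x≁y , trans (cong suc CH'≡C) (+-comm 1 C))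
    where
    CH'≡C : CH' ≡ C
    CH'≡C = classes-unique (classes-merge cl x y tt tt x≁y) components (λ a b _ _ s → G⊆merge a b s)
              (λ a b _ _ m → merge⊆G a b m)

deg-one : ∀ {n} (G : Graph n) (R : Rotation G) x y → Adj G x y → rot R x y ≡ y → deg G x ≡ 1
deg-one G R x y xy fixed = ≤-antisym (subst (deg G x ≤_) (count-singleton y) (count-mono _ _ only-y)) (count-pos _ y xy)
  where
  only-y : ∀ u → T (adj G x u) → T (does (u ≟F y))
  only-y u p with rot-cyc R x y u xy p
  ... | k , ek = subst (λ w → T (does (w ≟F y))) (trans (sym≡ (iter-fixed (rot R x) y fixed k)) ek) (≟-refl y)

deg-≥2 : ∀ {n} (G : Graph n) (R : Rotation G) x y → Adj G x y → rot R x y ≢ y → 2 ≤ deg G x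
deg-≥2 G R x y xy moved = count-≥2 (adj G x) y (rot R x y) xy (rot-adj R x y xy) (λ e → moved (sym≡ e))

-- Isolated vertices; each counts as a face in the Euler formula of `Defs`.
isolatedᵇ : ∀ {n} → Graph n → Fin n → Bool
isolatedᵇ G v = deg G v ≤ᵇ 0

isolated : ∀ {n} → Graph n → ℕ
isolated G = countTrue (isolatedᵇ G)

≤ᵇ0-true : ∀ m → m ≡ 0 → (m ≤ᵇ 0) ≡ true
≤ᵇ0-true .0 refl = refl

≤ᵇ0-false : ∀ m → 1 ≤ m → (m ≤ᵇ 0) ≡ false
≤ᵇ0-false (suc m) _ = refl

module IsolatedCount {n : ℕ} (G : Graph n) (x y : Fin n) (xy : Adj G x y) (R : Rotation G) where
  open EdgeDeletion G x y xy
  open FaceSurgery G x y xy R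

  endpoint-isolated : ∀ u v → IsE u v → indicator (isolatedᵇ H u) ≡ indicator (does (φ (u , v) ≟P (u , v)))
  endpoint-isolated u v e with φ (u , v) ≟P (u , v)
  ... | yes fixed = cong indicator (≤ᵇ0-true (deg H u) (+-cancelʳ-≡ 1 _ _ (trans (degH-endpoint u v e) degG≡1)))
    where
    degG≡1 : deg G u ≡ 1
    degG≡1 = deg-one G R u v (IsE-adj u v e) (,-injectiveʳ (trans (sym≡ (φ-endpoint u v e)) fixed))
  ... | no moved = cong indicator (≤ᵇ0-false (deg H u) (≤-pred (subst (2 ≤_) (sym≡ (trans (+-comm 1 _) (degH-endpoint u v e))) degG≥2)))
    where
    degG≥2 : 2 ≤ deg G u
    degG≥2 = deg-≥2 G R u v (IsE-adj u v e) (λ r → moved (trans (φ-endpoint u v e) (cong (u ,_) r)))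

  endpoint-not-isolated : ∀ u v → IsE u v → indicator (isolatedᵇ G u) ≡ 0
  endpoint-not-isolated u v e = cong indicator (≤ᵇ0-false (deg G u) (count-pos _ v (IsE-adj u v e)))

  isolated-H : isolated H ≡ isolated G + loop dxy + loop dyx
  isolated-H =
    begin
      isolated H
    ≡⟨ trans (+-identityʳ _) (+-identityʳ _) ⟨
      isolated H + 0 + 0
    ≡⟨ cong₂ (λ a b → isolated H + a + b) (endpoint-not-isolated x y InE-dxy) (endpoint-not-isolated y x InE-dyx) ⟨
      isolated H + indicator (isolatedᵇ G x) + indicator (isolatedᵇ G y)
    ≡⟨ count-update₂ (isolatedᵇ G) (isolatedᵇ H) x y x≢y (λ v nx ny → cong (_≤ᵇ 0) (sym≡ (degH-other v nx ny))) ⟨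
      isolated G + indicator (isolatedᵇ H x) + indicator (isolatedᵇ H y)
    ≡⟨ cong₂ (λ a b → isolated G + a + b) (endpoint-isolated x y InE-dxy) (endpoint-isolated y x InE-dyx) ⟩
      isolated G + loop dxy + loop dyx
    ∎
    where open ≡-Reasoning

-- A rotation system together with labellings of its faces and of its
-- components: a planar embedding except for the Euler equation.
record Embedding {n : ℕ} (G : Graph n) : Set where
  field
    R : Rotation G
    F : ℕ
    faces : Classes (IsDart G) (SameFace R) F
    C : ℕ
    components : Classes (λ (_ : Fin n) → ⊤) (Connected G) C

eulerL eulerR : ∀ {n} {G : Graph n} → Embedding G → ℕ
eulerL {n} {G} e = n + (Embedding.F e + isolated G)
eulerR {n} {G} e = 2 * Embedding.C e + numEdges G

data EulerStep (l r l' r' : ℕ) : Set where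
  -- the two darts lie on different faces, which merge
  faces-merge : l' + 1 ≡ l → r' + 1 ≡ r → EulerStep l r l' r'
  -- one face, and the edge is a bridge: its face splits and a component appears
  bridge-cut : l' ≡ l + 1 → r' ≡ r + 1 → EulerStep l r l' r'
  -- one face, but not a bridge: impossible in the plane
  handle-cut : l' ≡ l + 1 → r' + 1 ≡ r → EulerStep l r l' r'

module DeletionEmbedding {n : ℕ} (G : Graph n) (x y : Fin n) (xy : Adj G x y) (eG : Embedding G) where
  open Embedding eG
  open EdgeDeletion G x y xy
  open DeletedRotation G x y xy R
  open FaceSurgery G x y xy R
  open FaceCount G x y xy R F faces
  open ComponentCount G x y xy C components
  open IsolatedCount G x y xy R

  shift : ∀ m a i → m + (a + i) + 1 ≡ m + ((a + 1) + i)
  shift = solve-∀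

  deleted-embedding : Σ (Embedding H) λ eH → EulerStep (eulerL eG) (eulerR eG) (eulerL eH) (eulerR eH)
  deleted-embedding with faces-of-H | components-of-H
  ... | FH , facesH , face-change | CH , componentsH , component-change =
    record { R = RH ; F = FH ; faces = facesH ; C = CH ; components = componentsH } , step face-change component-change
    where
    lhs-H : n + (FH + isolated H) ≡ n + ((FH + loop dxy + loop dyx) + isolated G)
    lhs-H = trans (cong (λ i → n + (FH + i)) isolated-H) (rearrange n FH (loop dxy) (loop dyx) (isolated G))
      where
      rearrange : ∀ m f a b i → m + (f + (i + a + b)) ≡ m + (f + a + b + i)
      rearrange = solve-∀
    lhs-grows : FH + loop dxy + loop dyx ≡ F + 1 → n + (FH + isolated H) ≡ n + (F + isolated G) + 1
    lhs-grows eF = trans lhs-H (trans (cong (λ f → n + (f + isolated G)) eF) (sym≡ (shift n F (isolated G))))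
    rhs-same : CH ≡ C → 2 * CH + numEdges H + 1 ≡ 2 * C + numEdges G
    rhs-same eC = trans (+-assoc (2 * CH) _ 1) (cong₂ (λ c e → 2 * c + e) eC numEdgesH)
    rhs-grows : CH ≡ C + 1 → 2 * CH + numEdges H ≡ 2 * C + numEdges G + 1
    rhs-grows eC = trans (cong (λ c → 2 * c + numEdges H) eC)
                     (trans (double-shift C (numEdges H)) (cong (λ e → 2 * C + e + 1) numEdgesH))
      where
      double-shift : ∀ c e → 2 * (c + 1) + e ≡ 2 * c + (e + 1) + 1
      double-shift = solve-∀
    step : ((¬ OG dxy dyx × Connected H x y × FH + loop dxy + loop dyx + 1 ≡ F) ⊎ (OG dxy dyx × FH + loop dxy + loop dyx ≡ F + 1)) →
           ((Connected H x y × CH ≡ C) ⊎ (¬ Connected H x y × CH ≡ C + 1)) →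
           EulerStep (eulerL eG) (eulerR eG) (n + (FH + isolated H)) (2 * CH + numEdges H)
    step (inj₁ (_ , x~y , _)) (inj₂ (x≁y , _)) = ⊥-elim (x≁y x~y)
    step (inj₁ (_ , _ , eF)) (inj₁ (_ , eC)) =
      faces-merge (trans (cong (_+ 1) lhs-H) (trans (shift n _ (isolated G)) (cong (λ f → n + (f + isolated G)) eF))) (rhs-same eC)
    step (inj₂ (_ , eF)) (inj₂ (_ , eC)) = bridge-cut (lhs-grows eF) (rhs-grows eC)
    step (inj₂ (_ , eF)) (inj₁ (_ , eC)) = handle-cut (lhs-grows eF) (rhs-same eC)

toEmbedding : ∀ {n} {G : Graph n} → PlanarEmbedding G → Embedding G
toEmbedding pe = record
  { R = R
  ; F = F
  ; faces = record
    { lab = face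
    ; lab-sound = λ d d' → Equivalence.to (face-eq d d')
    ; lab-complete = λ d d' → Equivalence.from (face-eq d d')
    ; lab-onto = face-surj }
  ; C = C
  ; components = record
    { lab = λ d → comp (proj₁ d)
    ; lab-sound = λ d d' → Equivalence.to (comp-eq (proj₁ d) (proj₁ d'))
    ; lab-complete = λ d d' → Equivalence.from (comp-eq (proj₁ d) (proj₁ d'))
    ; lab-onto = λ c → let (v , e) = comp-surj c in (v , tt) , e } }
  where open PlanarEmbedding pe

fromEmbedding : ∀ {n} {G : Graph n} (e : Embedding G) → eulerL e ≡ eulerR e → PlanarEmbedding G
fromEmbedding e euler = record
  { R = R
  ; F = F
  ; face = lab faces
  ; face-eq = λ d d' → mk⇔ (lab-sound faces d d') (lab-complete faces d d')
  ; face-surj = lab-onto faces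
  ; C = C
  ; comp = λ v → lab components (v , tt)
  ; comp-eq = λ u v → mk⇔ (lab-sound components (u , tt) (v , tt)) (lab-complete components (u , tt) (v , tt))
  ; comp-surj = λ c → let ((v , _) , q) = lab-onto components c in v , q
  ; euler = euler }
  where open Embedding e

-- Euler's inequality for a graph without edges: no faces, all n vertices
-- are isolated, and there are at least n components.
euler-edgeless : ∀ {n} (G : Graph n) (e : Embedding G) → numEdges G ≡ 0 → eulerL e ≤ eulerR e
euler-edgeless {n} G e no-edges =
  begin
    n + (F + isolated G)  ≡⟨ cong₂ (λ f i → n + (f + i)) F≡0 isolated≡n ⟩
    n + n                 ≤⟨ +-mono-≤ n≤C (≤-trans n≤C (m≤m+n C 0)) ⟩
    C + (C + 0)           ≡⟨ +-identityʳ _ ⟨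
    2 * C + 0             ≡⟨ cong (2 * C +_) no-edges ⟨
    2 * C + numEdges G    ∎
  where
  open Embedding e
  open ≤-Reasoning
  no-edge : ∀ u v → ¬ Adj G u v
  no-edge u v p = <⇒≱ (subst (1 ≤_) no-edges (edge⇒numEdges-pos G u v p)) z≤n
  F≡0 : F ≡ 0
  F≡0 with F | faces
  ... | zero | _ = refl
  ... | suc _ | cl with lab-onto cl zero
  ... | ((u , v) , p) , _ = ⊥-elim (no-edge u v p)
  isolated≡n : isolated G ≡ n
  isolated≡n = trans (count-ext _ _ (λ v → ≤ᵇ0-true _ (deg≡0 v))) count-true
    where
    deg≡0 : ∀ v → deg G v ≡ 0
    deg≡0 v = trans (count-ext _ _ (λ w → not-adj w)) (count-false {n})
      where
      not-adj : ∀ w → adj G v w ≡ false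
      not-adj w with adj G v w in q
      ... | true = ⊥-elim (no-edge v w (subst T (sym≡ q) tt))
      ... | false = refl
  n≤C : n ≤ C
  n≤C = injective⇒≤ {f = λ v → lab components (v , tt)} separated
    where
    separated : ∀ {u v} → lab components (u , tt) ≡ lab components (v , tt) → u ≡ v
    separated {u} {v} q with lab-sound components (u , tt) (v , tt) q
    ... | ε = refl
    ... | p ◅ _ = ⊥-elim (no-edge _ _ p)

euler-step-≤ : ∀ {l r l' r'} → EulerStep l r l' r' → l' ≤ r' → l ≤ r
euler-step-≤ (faces-merge el er) le = subst₂ _≤_ el er (+-monoˡ-≤ 1 le)
euler-step-≤ (bridge-cut el er) le = +-cancelʳ-≤ 1 _ _ (subst₂ _≤_ el er le)
euler-step-≤ (handle-cut el er) le = ≤-trans (m≤m+n _ 1) (subst₂ _≤_ el er (≤-trans le (m≤m+n _ 1)))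

euler-step-≡ : ∀ {l r l' r'} → EulerStep l r l' r' → l ≡ r → l' ≤ r' → l' ≡ r'
euler-step-≡ (faces-merge el er) eq _ = +-cancelʳ-≡ 1 _ _ (trans el (trans eq (sym≡ er)))
euler-step-≡ (bridge-cut el er) eq _ = trans el (trans (cong (_+ 1) eq) (sym≡ er))
euler-step-≡ {l' = l'} {r'} (handle-cut el er) eq le = ⊥-elim (<⇒≱ r'<l' le)
  where
  r'<l' : r' < l'
  r'<l' = ≤-trans (≤-trans (≤-reflexive (+-comm 1 r')) (m≤m+n (r' + 1) 1))
                  (≤-reflexive (sym≡ (trans el (trans (cong (_+ 1) eq) (cong (_+ 1) (sym≡ er))))))

some-edge : ∀ {n} (G : Graph n) → 1 ≤ numEdges G → ∃[ i ] ∃[ j ] Adj G i j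
some-edge G pos with sumFin-pos (upRow G) pos
... | i , row-i with count-exists _ row-i
... | j , ij = i , j , proj₁ (∧-elim (adj G i j) ij)

euler-inequality : ∀ m {n} (G : Graph n) (e : Embedding G) → numEdges G ≡ m → eulerL e ≤ eulerR e
euler-inequality zero G e no-edges = euler-edgeless G e no-edges
euler-inequality (suc m) G e edges with some-edge G (subst (1 ≤_) (sym≡ edges) (s≤s z≤n))
... | i , j , ij with DeletionEmbedding.deleted-embedding G i j ij e
... | eH , step = euler-step-≤ step (euler-inequality m _ eH numEdgesH≡m)
  where
  numEdgesH≡m : numEdges (EdgeDeletion.H G i j ij) ≡ m
  numEdgesH≡m = suc-injective (trans (+-comm 1 _) (trans (EdgeDeletion.numEdgesH G i j ij) edges))

planar-deletion : ∀ {n} (G : Graph n) x y (xy : Adj G x y) → Planar G → Planar (EdgeDeletion.H G x y xy)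
planar-deletion G x y xy pe with DeletionEmbedding.deleted-embedding G x y xy (toEmbedding pe)
... | eH , step = fromEmbedding eH (euler-step-≡ step (PlanarEmbedding.euler pe) (euler-inequality _ _ eH refl))

module DeletionMeasures {n : ℕ} (G : Graph n) (x y : Fin n) (xy : Adj G x y) where
  open EdgeDeletion G x y xy

  girth-deletion : ∀ g → GirthAtLeast g G → GirthAtLeast g H
  girth-deletion g girth m 3≤ <g f (inj , steps , closing) =
    girth m 3≤ <g f (inj , (λ i → H→G _ _ (steps i)) , H→G _ _ closing)

  numBig-deletion : numBig H ≤ numBig G
  numBig-deletion = count-mono _ _ (λ v big → ≤⇒≤ᵇ (≤-trans (≤ᵇ⇒≤ 3 _ big) (degH-≤ v)))

  size-deletion : size H < size G
  size-deletion = +-monoʳ-< n (subst (numEdges H <_) numEdgesH (≤-reflexive (+-comm 1 (numEdges H))))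

sameNbrs : ∀ {n} → Graph n → (Fin n → Color) → Fin n → ℕ
sameNbrs Γ col v = countTrue (λ w → adj Γ v w ∧ sameColor (col w) (col v))

sameColor⇒≡ : ∀ a b → T (sameColor a b) → a ≡ b
sameColor⇒≡ c3 c3 _ = refl
sameColor⇒≡ c4 c4 _ = refl

colour3? : ∀ c → Dec (c ≡ c3)
colour3? c3 = yes refl
colour3? c4 = no λ ()

other-colour : ∀ {c} → c ≢ c3 → c ≡ c4
other-colour {c3} c≢3 = ⊥-elim (c≢3 refl)
other-colour {c4} _ = refl

sameNbrs-≤deg : ∀ {n} (Γ : Graph n) col v → sameNbrs Γ col v ≤ deg Γ v
sameNbrs-≤deg Γ col v = count-mono _ _ (λ w p → proj₁ (∧-elim (adj Γ v w) p))

saturated : ∀ {n} (Γ : Graph n) col v → deg Γ v ≤ sameNbrs Γ col v → ∀ w → Adj Γ v w → col w ≡ col v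
saturated Γ col v le w p =
  sameColor⇒≡ _ _ (proj₂ (∧-elim (adj Γ v w) (count-≤-reflects _ (adj Γ v) (λ u q → proj₁ (∧-elim (adj Γ v u) q)) le w p)))

-- A (3,4)-colouring of G − xy extends to G when x and y have degree ≤ 4:
-- recolour with colour 4 each endpoint of colour 3 that has four
-- neighbours of colour 3.  It has at most 4 neighbours, and since all of
-- them have colour 3 no other vertex gains a neighbour of its colour.
module ColourExtension {n : ℕ} (G : Graph n) (x y : Fin n) (xy : Adj G x y)
                       (deg-x : deg G x ≤ 4) (deg-y : deg G y ≤ 4)
                       (col : Fin n → Color) (col-ok : Is34Coloring (EdgeDeletion.H G x y xy) col) where
  open EdgeDeletion G x y xy

  Endpoint : Fin n → Set
  Endpoint v = v ≡ x ⊎ v ≡ y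

  endpoint-deg : ∀ {v} → Endpoint v → deg G v ≤ 4
  endpoint-deg (inj₁ refl) = deg-x
  endpoint-deg (inj₂ refl) = deg-y

  Recolour : Fin n → Set
  Recolour v = Endpoint v × col v ≡ c3 × 4 ≤ sameNbrs G col v

  recolour? : ∀ v → Dec (Recolour v)
  recolour? v = ((v ≟F x) ⊎-dec (v ≟F y)) ×-dec colour3? (col v) ×-dec (4 ≤? sameNbrs G col v)

  col′ : Fin n → Color
  col′ v = if does (recolour? v) then c4 else col v

  col′-recoloured : ∀ v → Recolour v → col′ v ≡ c4
  col′-recoloured v r rewrite dec-true (recolour? v) r = refl

  col′-kept : ∀ v → ¬ Recolour v → col′ v ≡ col v
  col′-kept v ¬r rewrite dec-false (recolour? v) ¬r = refl

  recoloured-nbrs : ∀ w v → Recolour w → Adj G w v → col v ≡ c3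
  recoloured-nbrs w v (e , c≡3 , four≤) p =
    trans (saturated G col w (≤-trans (endpoint-deg e) four≤) v p) c≡3

  kept-count : ∀ v → ¬ Recolour v → sameNbrs G col′ v ≤ sameNbrs G col v
  kept-count v ¬r = count-mono _ _ λ w q →
    let (p , s) = ∧-elim (adj G v w) q in ∧-intro p (same-before w p s)
    where
    same-before : ∀ w → Adj G v w → T (sameColor (col′ w) (col′ v)) → T (sameColor (col w) (col v))
    same-before w p s with recolour? w
    ... | no ¬rw = subst₂ (λ a b → T (sameColor a b)) (col′-kept w ¬rw) (col′-kept v ¬r) s
    ... | yes rw = ⊥-elim (subst₂ (λ a b → T (sameColor a b)) (col′-recoloured w rw)
                                  (trans (col′-kept v ¬r) (recoloured-nbrs w v rw (adj-sym G v w p))) s)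

  kept-bound : ∀ v → ¬ Recolour v → sameNbrs G col v ≤ capacity (col v)
  kept-bound v ¬r with (v ≟F x) ⊎-dec (v ≟F y)
  ... | no ¬e = subst (_≤ capacity (col v)) same-as-H (col-ok v)
    where
    same-as-H : sameNbrs H col v ≡ sameNbrs G col v
    same-as-H = count-ext _ _ λ w → cong (_∧ _) (adjH-¬E v w λ { (inj₁ (e , _)) → ¬e (inj₁ e) ; (inj₂ (e , _)) → ¬e (inj₂ e) })
  ... | yes e with colour3? (col v)
  ...   | yes c≡3 = subst (λ c → sameNbrs G col v ≤ capacity c) (sym≡ c≡3) (≤-pred (≰⇒> λ four≤ → ¬r (e , c≡3 , four≤)))
  ...   | no c≢3 = subst (λ c → sameNbrs G col v ≤ capacity c) (sym≡ (other-colour c≢3))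
                         (≤-trans (sameNbrs-≤deg G col v) (endpoint-deg e))

  extended : Is34Coloring G col′
  extended v with recolour? v
  ... | yes r = subst (λ c → sameNbrs G col′ v ≤ capacity c) (sym≡ (col′-recoloured v r))
                      (≤-trans (sameNbrs-≤deg G col′ v) (endpoint-deg (proj₁ r)))
  ... | no ¬r = subst (λ c → sameNbrs G col′ v ≤ capacity c) (sym≡ (col′-kept v ¬r))
                      (≤-trans (kept-count v ¬r) (kept-bound v ¬r))

lemma2p1 : ∀ (n : ℕ) (G : Graph n) → InClass G → Minimal G →
    ∀ (x y : Fin n) → Adj G x y → 5 ≤ deg G x ⊎ 5 ≤ deg G y
lemma2p1 n G (planar , girth , not-colourable) minimal x y xy with 5 ≤? deg G x | 5 ≤? deg G y
... | yes big | _ = inj₁ big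
... | no _ | yes big = inj₂ big
... | no small-x | no small-y = ⊥-elim (<⇒≱ size-deletion (proj₂ (minimal n H H-in-class) same-numBig))
  where
  open EdgeDeletion G x y xy
  open DeletionMeasures G x y xy
  H-in-class : InClass H
  H-in-class = planar-deletion G x y xy planar , girth-deletion 5 girth ,
               λ (col , col-ok) → not-colourable (_ , ColourExtension.extended G x y xy
                                                         (≤-pred (≰⇒> small-x)) (≤-pred (≰⇒> small-y)) col col-ok)
  same-numBig : numBig G ≡ numBig H
  same-numBig = ≤-antisym (proj₁ (minimal n H H-in-class)) numBig-deletion
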